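{- Let $T$ be a perfect $k$-ary tree of depth $d$ whose leaves are labelled by a map $\varphi$ into $\{1,\dots,q\}$. For a node $x$ let $T_x$ be the subtree rooted at $x$ and $\mu_i(T_x)$ the fraction of leaves of $T_x$ with label $i$. Then $$\mathbf{E}_{u,t\sim\mathcal{P}}\Big[\frac1k\sum_{y\in\mathrm{child}(u(t))}\sum_{i=1}^q\big|\mu_i(T_y)-\mu_i(T_{u(t)})\big|\Big]\le\sqrt{\frac{2\log_2q}{d}}.$$
   Context: $\mathrm{child}(x)$ is the set of $k$ children of an internal node $x$. The distribution $\mathcal{P}$: pick a uniformly random leaf $u$ of $T$, let $u(0),u(1),\dots,u(d)=u$ be the path from the root $u(0)$ to $u$, pick $t$ uniformly in $\{0,\dots,d-1\}$ independently, and output the internal node $u(t)$. -}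

module Defs where

open import Data.Nat using (ℕ; zero; suc; _^_)
import Data.Nat
open import Data.Fin using (Fin; _≟_)
open import Data.List using (List; []; _∷_; map; concatMap; foldr; take; upTo; allFin)
open import Data.Product using (Σ; _,_)
open import Data.Integer using (+_)
open import Data.Rational using (ℚ; 0ℚ; _+_; _-_; _*_; ∣_∣; _/_)
open import Relation.Nullary using (yes; no)

-- A perfect k-ary tree of depth d whose leaves carry labels in Fin q
-- (Fin q stands for {1,…,q}).  Leaves are at depth 0, node c has children c 0 … c (k-1).
data Tree (k q : ℕ) : ℕ → Set where
  leaf : Fin q → Tree k q zero
  node : {d : ℕ} → (Fin k → Tree k q d) → Tree k q (suc d)

sumℚ : List ℚ → ℚ
sumℚ = foldr _+_ 0ℚ

-- a / n as a rational, with the (never used) convention a / 0 = 0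
frac : ℕ → ℕ → ℚ
frac a zero = 0ℚ
frac a (suc n) = (+ a) / suc n

numLeaves : {k q d : ℕ} → Tree k q d → ℕ
numLeaves {k} {d = d} _ = k ^ d

count : {k q d : ℕ} → Fin q → Tree k q d → ℕ
count i (leaf j) with i ≟ j
... | yes _ = 1
... | no _ = 0
count i (node c) = sumℕ (map (λ y → count i (c y)) (allFin _))
  where
  sumℕ : List ℕ → ℕ
  sumℕ = foldr Data.Nat._+_ 0

μ : {k q d : ℕ} → Fin q → Tree k q d → ℚ
μ i T = frac (count i T) (numLeaves T)

-- The quantity inside the expectation, for an internal node x:
--   (1/k) Σ_{y ∈ child(x)} Σ_{i=1}^q |μ_i(T_y) − μ_i(T_x)|
-- (the value at a leaf is irrelevant; it is never evaluated there)
divergence : {k q d : ℕ} → Tree k q d → ℚ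
divergence (leaf _) = 0ℚ
divergence {k} {q} (node c) =
  frac 1 k * sumℚ (map (λ y → sumℚ (map (λ i → ∣ μ i (c y) - μ i (node c) ∣) (allFin q))) (allFin k))

paths : (k d : ℕ) → List (List (Fin k))
paths k zero = [] ∷ []
paths k (suc d) = concatMap (λ j → map (j ∷_) (paths k d)) (allFin k)

subtreeAt : {k q d : ℕ} → Tree k q d → List (Fin k) → Σ ℕ (Tree k q)
subtreeAt T [] = _ , T
subtreeAt (leaf l) (_ ∷ _) = _ , leaf l
subtreeAt (node c) (j ∷ p) = subtreeAt (c j) p

divAt : {k q : ℕ} → Σ ℕ (Tree k q) → ℚ
divAt (_ , T) = divergence T

-- E_{(u,t) ~ P}[ divergence(u(t)) ] : u uniform leaf (path of length d),
-- t uniform in {0,…,d-1}, u(t) = node at depth t on the root-to-u path.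
expectation : {k q d : ℕ} → Tree k q d → ℚ
expectation {k} {d = d} T =
  frac 1 (k ^ d Data.Nat.* d) *
  sumℚ (map (λ u → sumℚ (map (λ t → divAt (subtreeAt T (take t u))) (upTo d))) (paths k d))

{-# OPTIONS --safe #-}
-- Write N = k ^ d and c_i(x) for the number of leaves of T_x labelled i.  Clearing denominators, k N d times
-- the expectation is the natural number  Y = Σ_x Σ_{y ∈ child(x)} Σ_i ∣k c_i(y) - c_i(x)∣,  and the claim
-- becomes 2 ^ (Y ^ 2) ≤ q ^ (2 k² N² d).  Everything is proved over ℕ in exponential form, without logarithms.
-- 1. Linearised Pinsker: for label distributions p = c / m and P = C / M and all α, β,
--    2αβ ‖p - P‖₁ - α² ≤ 2β² D(p ‖ P) in bits.  Walk from p to P in five equal steps; weighted AM–GM bounds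
--    each step, the gain being a square, and (1 - s/v) ^ (4v) ≤ 2 ^ (-5s) collects the steps into a power of 2.
-- 2. Summed over all nodes the divergences telescope (chain rule) to N times the entropy of the root
--    distribution, which is at most N log q by Gibbs' inequality, the case α = 0 of 1.
-- 3. Choosing α = Y and β = k N d turns the linear bound of 1. and 2. into the quadratic one.
module Submission where

module NatLemmas where
  open import Data.Nat
  open import Data.Nat.Properties
  open import Data.Fin using (Fin; zero; suc; toℕ; punchIn)
  open import Data.Fin.Properties using (punchInᵢ≢i)
  open import Function using (_∘_)
  open import Relation.Binary.PropositionalEquality
  open import Relation.Nullary using (yes; no)
  open import Data.Empty using (⊥-elim)
  open import Data.Nat.Tactic.RingSolver using (solve-∀)
  import Algebra.Properties.Semiring.Sum +-*-semiring as Sum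
  import Algebra.Properties.CommutativeMonoid.Sum *-1-commutativeMonoid as Product

  open Sum public using (∑-distrib-+; ∑-comm) renaming (sum to ∑; sum-cong-≗ to ∑-cong)
  open Product public using ()
    renaming (sum to ∏; sum-cong-≗ to ∏-cong; ∑-distrib-+ to ∏-distrib-*; ∑-comm to ∏-comm)
  open import Algebra.Properties.CommutativeSemigroup *-commutativeSemigroup public using ()
    renaming (interchange to *-interchange; x∙yz≈y∙xz to x*[y*z]≡y*[x*z])

  ^-positive : ∀ {m} n → 0 < m → 0 < m ^ n
  ^-positive {m} n m>0 = m^n>0 m {{>-nonZero m>0}} n

  n^n>0 : ∀ n → 0 < n ^ n
  n^n>0 zero = s≤s z≤n
  n^n>0 (suc n) = ^-positive (suc n) (s≤s z≤n)

  ^-distribʳ-* : ∀ m n o → (m * n) ^ o ≡ m ^ o * n ^ o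
  ^-distribʳ-* m n zero = refl
  ^-distribʳ-* m n (suc o) = begin
    m * n * (m * n) ^ o      ≡⟨ cong (m * n *_) (^-distribʳ-* m n o) ⟩
    m * n * (m ^ o * n ^ o)  ≡⟨ *-interchange m n (m ^ o) (n ^ o) ⟩
    m * m ^ o * (n * n ^ o)  ∎
    where open ≡-Reasoning

  *-cancelˡ-≤-pos : ∀ {m n} o → 0 < o → o * m ≤ o * n → m ≤ n
  *-cancelˡ-≤-pos o o>0 = *-cancelˡ-≤ o {{>-nonZero o>0}}

  ^-cancelʳ-≤ : ∀ {m n} o → 0 < o → m ^ o ≤ n ^ o → m ≤ n
  ^-cancelʳ-≤ {m} {n} o o>0 le with m ≤? n
  ... | yes m≤n = m≤n
  ... | no m≰n = ⊥-elim (<⇒≱ (^-monoˡ-< o {{>-nonZero o>0}} (≰⇒> m≰n)) le)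

  ∑-const : ∀ n c → ∑ {n} (λ _ → c) ≡ n * c
  ∑-const zero c = refl
  ∑-const (suc n) c = cong (c +_) (∑-const n c)

  *-distribˡ-∑ : ∀ {n} m (f : Fin n → ℕ) → m * ∑ f ≡ ∑ (λ i → m * f i)
  *-distribˡ-∑ = Sum.*-distribˡ-sum

  ∑-indicator : ∀ {n} (j : Fin n) {f : Fin n → ℕ} → f j ≡ 1 → (∀ i → i ≢ j → f i ≡ 0) → ∑ f ≡ 1
  ∑-indicator {suc n} j {f} fj≡1 f≡0 = begin
    ∑ f                      ≡⟨ Sum.sum-remove {i = j} f ⟩
    f j + ∑ (f ∘ punchIn j)  ≡⟨ cong₂ _+_ fj≡1 (∑-cong (λ i → f≡0 (punchIn j i) (punchInᵢ≢i j i))) ⟩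
    1 + ∑ {n} (λ _ → 0)      ≡⟨ cong suc (trans (∑-const n 0) (*-zeroʳ n)) ⟩
    1                        ∎
    where open ≡-Reasoning

  ∏-const : ∀ n c → ∏ {n} (λ _ → c) ≡ c ^ n
  ∏-const zero c = refl
  ∏-const (suc n) c = cong (c *_) (∏-const n c)

  ∏-mono-≤ : ∀ {n} {f g : Fin n → ℕ} → (∀ i → f i ≤ g i) → ∏ f ≤ ∏ g
  ∏-mono-≤ {zero} f≤g = ≤-refl
  ∏-mono-≤ {suc n} f≤g = *-mono-≤ (f≤g zero) (∏-mono-≤ (f≤g ∘ suc))

  ∏-positive : ∀ {n} {f : Fin n → ℕ} → (∀ i → 0 < f i) → 0 < ∏ f
  ∏-positive {zero} f>0 = ≤-refl
  ∏-positive {suc n} f>0 = *-mono-≤ (f>0 zero) (∏-positive (f>0 ∘ suc))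

  ^-∑ : ∀ {n} m (f : Fin n → ℕ) → m ^ ∑ f ≡ ∏ (λ i → m ^ f i)
  ^-∑ {zero} m f = refl
  ^-∑ {suc n} m f = trans (^-distribˡ-+-* m (f zero) (∑ (f ∘ suc))) (cong (m ^ f zero *_) (^-∑ m (f ∘ suc)))

  ∏-^ : ∀ {n} (f : Fin n → ℕ) o → ∏ (λ i → f i ^ o) ≡ ∏ f ^ o
  ∏-^ {zero} f o = sym (^-zeroˡ o)
  ∏-^ {suc n} f o = trans (cong (f zero ^ o *_) (∏-^ (f ∘ suc) o)) (sym (^-distribʳ-* (f zero) (∏ (f ∘ suc)) o))


  ^-swap : ∀ a b c → (a ^ b) ^ c ≡ (a ^ c) ^ b
  ^-swap a b c = trans (^-*-assoc a b c) (trans (cong (a ^_) (*-comm b c)) (sym (^-*-assoc a c b)))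

  ^-≤-rescale : ∀ {x y a b s r} → 0 < r → a * r ≡ b * s → x ^ s ≤ y ^ r → x ^ a ≤ y ^ b
  ^-≤-rescale {x} {y} {a} {b} {s} {r} r>0 a*r≡b*s xˢ≤yʳ = ^-cancelʳ-≤ r r>0 (begin
    (x ^ a) ^ r  ≡⟨ ^-*-assoc x a r ⟩
    x ^ (a * r)  ≡⟨ cong (x ^_) (trans a*r≡b*s (*-comm b s)) ⟩
    x ^ (s * b)  ≡⟨ ^-*-assoc x s b ⟨
    (x ^ s) ^ b  ≤⟨ ^-monoˡ-≤ b xˢ≤yʳ ⟩
    (y ^ r) ^ b  ≡⟨ ^-swap y r b ⟩
    (y ^ b) ^ r  ∎)
    where open ≤-Reasoning

  telescope-≤ : ∀ n (g P : ℕ → ℕ) → (∀ t → t < n → g t * P (suc t) ≤ P t) → ∏ {n} (g ∘ toℕ) * P n ≤ P 0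
  telescope-≤ zero g P steps = ≤-reflexive (+-identityʳ (P 0))
  telescope-≤ (suc n) g P steps = begin
    g 0 * ∏ {n} (g ∘ suc ∘ toℕ) * P (suc n)    ≡⟨ *-assoc (g 0) _ _ ⟩
    g 0 * (∏ {n} (g ∘ suc ∘ toℕ) * P (suc n))  ≤⟨ *-monoʳ-≤ (g 0) (telescope-≤ n (g ∘ suc) (P ∘ suc) later-steps) ⟩
    g 0 * P 1                                  ≤⟨ steps 0 (s≤s z≤n) ⟩
    P 0                                        ∎
    where
    open ≤-Reasoning
    later-steps : ∀ t → t < n → g (suc t) * P (suc (suc t)) ≤ P (suc t)
    later-steps t t<n = steps (suc t) (s≤s t<n)

module RationalLemmas where
  open import Data.Nat as ℕ using (ℕ; zero; suc)
  import Data.Nat.Properties as ℕ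
  import Data.Integer as ℤ
  import Data.Integer.Properties as ℤ
  open import Data.Rational
    using (ℚ; mkℚ; _+_; _*_; _-_; -_; _≤_; _<_; 0ℚ; 1ℚ; ∣_∣; _/_; 1/_; toℚᵘ; *≤*; *<*; ≢-nonZero; positive; nonNegative)
  open import Data.Rational.Properties
  import Data.Rational.Unnormalised as ℚᵘ
  import Data.Rational.Unnormalised.Properties as ℚᵘ
  open import Data.Fin using (Fin; zero; suc)
  open import Data.Nat.Coprimality using (1-coprimeTo) renaming (sym to coprime-sym)
  open import Data.Sum using (inj₁; inj₂)
  open import Data.Empty using (⊥-elim)
  open import Relation.Nullary.Decidable.Core using (dec⇒maybe)
  open import Level using (0ℓ)
  open import Function using (_∘_)
  open import Relation.Binary.PropositionalEquality
  open import Relation.Nullary using (yes; no)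
  open import Defs using (frac)
  open NatLemmas using (∑; ∏)
  open import Algebra.Bundles using (CommutativeRing)
  open import Tactic.RingSolver using (solve-∀)
  import Tactic.RingSolver.Core.AlmostCommutativeRing as ACR
  import Algebra.Properties.Semiring.Sum (CommutativeRing.semiring +-*-commutativeRing) as Sum
  import Algebra.Properties.CommutativeMonoid.Sum *-1-commutativeMonoid as Product
  import Algebra.Properties.CommutativeSemiring.Exp (CommutativeRing.commutativeSemiring +-*-commutativeRing) as Exp
  open Exp public using (_^_; ^-distrib-*)

  open Sum public using () renaming (sum to ∑ℚ; sum-cong-≗ to ∑ℚ-cong; ∑-distrib-+ to ∑ℚ-distrib-+)
  open Product public using () renaming (sum to ∏ℚ; sum-cong-≗ to ∏ℚ-cong; ∑-distrib-+ to ∏ℚ-distrib-*)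

  ℚ-ring : ACR.AlmostCommutativeRing 0ℓ 0ℓ
  ℚ-ring = ACR.fromCommutativeRing +-*-commutativeRing (λ p → dec⇒maybe (0ℚ ≟ p))

  fromℕ : ℕ → ℚ
  fromℕ n = mkℚ (ℤ.+ n) 0 (coprime-sym (1-coprimeTo n))


  fromℕ-+ : ∀ m n → fromℕ (m ℕ.+ n) ≡ fromℕ m + fromℕ n
  fromℕ-+ m n = toℚᵘ-injective (ℚᵘ.≃-trans (ℚᵘ.*≡* eq) (ℚᵘ.≃-sym (toℚᵘ-homo-+ (fromℕ m) (fromℕ n))))
    where
    eq : ℤ.+ (m ℕ.+ n) ℤ.* ℤ.+ 1 ≡ (ℤ.+ m ℤ.* ℤ.+ 1 ℤ.+ ℤ.+ n ℤ.* ℤ.+ 1) ℤ.* ℤ.+ 1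
    eq rewrite ℤ.*-identityʳ (ℤ.+ m) | ℤ.*-identityʳ (ℤ.+ n) = cong (ℤ._* ℤ.+ 1) (ℤ.pos-+ m n)

  fromℕ-* : ∀ m n → fromℕ (m ℕ.* n) ≡ fromℕ m * fromℕ n
  fromℕ-* m n = toℚᵘ-injective
    (ℚᵘ.≃-trans (ℚᵘ.*≡* (cong (ℤ._* ℤ.+ 1) (ℤ.pos-* m n))) (ℚᵘ.≃-sym (toℚᵘ-homo-* (fromℕ m) (fromℕ n))))

  fromℕ-suc : ∀ n → fromℕ (suc n) ≡ 1ℚ + fromℕ n
  fromℕ-suc = fromℕ-+ 1

  fromℕ-mono-≤ : ∀ {m n} → m ℕ.≤ n → fromℕ m ≤ fromℕ n
  fromℕ-mono-≤ m≤n = *≤* (ℤ.*-monoʳ-≤-nonNeg (ℤ.+ 1) (ℤ.+≤+ m≤n))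

  fromℕ-cancel-≤ : ∀ {m n} → fromℕ m ≤ fromℕ n → m ℕ.≤ n
  fromℕ-cancel-≤ {m} {n} (*≤* le) = ℤ.drop‿+≤+ (subst₂ ℤ._≤_ (ℤ.*-identityʳ (ℤ.+ m)) (ℤ.*-identityʳ (ℤ.+ n)) le)

  fromℕ-injective : ∀ {m n} → fromℕ m ≡ fromℕ n → m ≡ n
  fromℕ-injective eq = ℕ.≤-antisym (fromℕ-cancel-≤ (≤-reflexive eq)) (fromℕ-cancel-≤ (≤-reflexive (sym eq)))

  fromℕ-nonNeg : ∀ n → 0ℚ ≤ fromℕ n
  fromℕ-nonNeg n = fromℕ-mono-≤ ℕ.z≤n

  fromℕ-pos : ∀ {n} → 0 ℕ.< n → 0ℚ < fromℕ n
  fromℕ-pos n>0 = <-≤-trans (*<* (ℤ.+<+ (ℕ.s≤s ℕ.z≤n))) (fromℕ-mono-≤ n>0)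

  fromℕ-∸ : ∀ {m n} → n ℕ.≤ m → fromℕ (m ℕ.∸ n) ≡ fromℕ m - fromℕ n
  fromℕ-∸ {m} {n} n≤m = begin
    fromℕ (m ℕ.∸ n)                      ≡⟨ add-sub (fromℕ (m ℕ.∸ n)) (fromℕ n) ⟨
    fromℕ (m ℕ.∸ n) + fromℕ n - fromℕ n  ≡⟨ cong (_- fromℕ n) (fromℕ-+ (m ℕ.∸ n) n) ⟨
    fromℕ (m ℕ.∸ n ℕ.+ n) - fromℕ n      ≡⟨ cong (λ x → fromℕ x - fromℕ n) (ℕ.m∸n+n≡m n≤m) ⟩
    fromℕ m - fromℕ n                    ∎
    where
    open ≡-Reasoning
    add-sub : ∀ p q → p + q - q ≡ p
    add-sub = solve-∀ ℚ-ring

  fromℕ-∸-≥ : ∀ m n → fromℕ m - fromℕ n ≤ fromℕ (m ℕ.∸ n)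
  fromℕ-∸-≥ m n with ℕ.≤-total n m
  ... | inj₁ n≤m = ≤-reflexive (sym (fromℕ-∸ n≤m))
  ... | inj₂ m≤n = ≤-trans (subst (fromℕ m - fromℕ n ≤_) (+-inverseʳ (fromℕ n)) (+-monoˡ-≤ (- fromℕ n) (fromℕ-mono-≤ m≤n)))
                           (fromℕ-nonNeg (m ℕ.∸ n))

  ∣fromℕ-fromℕ∣ : ∀ m n → ∣ fromℕ m - fromℕ n ∣ ≡ fromℕ ℕ.∣ m - n ∣
  ∣fromℕ-fromℕ∣ m n with ℕ.≤-total n m
  ... | inj₁ n≤m = begin
    ∣ fromℕ m - fromℕ n ∣  ≡⟨ cong ∣_∣ (fromℕ-∸ n≤m) ⟨
    ∣ fromℕ (m ℕ.∸ n) ∣    ≡⟨ 0≤p⇒∣p∣≡p (fromℕ-nonNeg _) ⟩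
    fromℕ (m ℕ.∸ n)        ≡⟨ cong fromℕ (ℕ.m≤n⇒∣n-m∣≡n∸m n≤m) ⟨
    fromℕ ℕ.∣ m - n ∣      ∎
    where open ≡-Reasoning
  ... | inj₂ m≤n = begin
    ∣ fromℕ m - fromℕ n ∣      ≡⟨ cong ∣_∣ (neg-sub (fromℕ m) (fromℕ n)) ⟩
    ∣ - (fromℕ n - fromℕ m) ∣  ≡⟨ ∣-p∣≡∣p∣ _ ⟩
    ∣ fromℕ n - fromℕ m ∣      ≡⟨ cong ∣_∣ (fromℕ-∸ m≤n) ⟨
    ∣ fromℕ (n ℕ.∸ m) ∣        ≡⟨ 0≤p⇒∣p∣≡p (fromℕ-nonNeg _) ⟩
    fromℕ (n ℕ.∸ m)            ≡⟨ cong fromℕ (ℕ.m≤n⇒∣m-n∣≡n∸m m≤n) ⟨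
    fromℕ ℕ.∣ m - n ∣          ∎
    where
    open ≡-Reasoning
    neg-sub : ∀ p q → p - q ≡ - (q - p)
    neg-sub = solve-∀ ℚ-ring

  /-*-fromℕ : ∀ a b .{{_ : ℕ.NonZero b}} → (ℤ.+ a) / b * fromℕ b ≡ fromℕ a
  /-*-fromℕ a (suc b) = toℚᵘ-injective (ℚᵘ.≃-trans (toℚᵘ-homo-* ((ℤ.+ a) / suc b) (fromℕ (suc b)))
    (ℚᵘ.≃-trans (ℚᵘ.*-congʳ {toℚᵘ (fromℕ (suc b))} (toℚᵘ-fromℚᵘ (ℚᵘ.mkℚᵘ (ℤ.+ a) b))) (ℚᵘ.*≡* eq)))
    where
    eq : (ℤ.+ a ℤ.* ℤ.+ suc b) ℤ.* ℤ.+ 1 ≡ ℤ.+ a ℤ.* ℤ.+ suc (b ℕ.* 1)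
    eq = trans (ℤ.*-identityʳ _) (cong (λ x → ℤ.+ a ℤ.* ℤ.+ suc x) (sym (ℕ.*-identityʳ b)))

  frac-*-fromℕ : ∀ a {n} → 0 ℕ.< n → frac a n * fromℕ n ≡ fromℕ a
  frac-*-fromℕ a {suc n} _ = /-*-fromℕ a (suc n)

  0≤+ : ∀ {p q} → 0ℚ ≤ p → 0ℚ ≤ q → 0ℚ ≤ p + q
  0≤+ = +-mono-≤

  *-monoˡ-≤-0≤ : ∀ {r p q} → 0ℚ ≤ r → p ≤ q → r * p ≤ r * q
  *-monoˡ-≤-0≤ {r} r≥0 = *-monoˡ-≤-nonNeg r {{nonNegative r≥0}}

  *-monoʳ-≤-0≤ : ∀ {r p q} → 0ℚ ≤ r → p ≤ q → p * r ≤ q * r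
  *-monoʳ-≤-0≤ {r} r≥0 = *-monoʳ-≤-nonNeg r {{nonNegative r≥0}}

  *-mono-≤-0≤ : ∀ {p q r s} → 0ℚ ≤ p → 0ℚ ≤ r → p ≤ q → r ≤ s → p * r ≤ q * s
  *-mono-≤-0≤ p≥0 r≥0 p≤q r≤s = ≤-trans (*-monoˡ-≤-0≤ p≥0 r≤s) (*-monoʳ-≤-0≤ (≤-trans r≥0 r≤s) p≤q)

  0≤* : ∀ {p q} → 0ℚ ≤ p → 0ℚ ≤ q → 0ℚ ≤ p * q
  0≤* {p} p≥0 q≥0 = subst (_≤ p * _) (*-zeroʳ p) (*-monoˡ-≤-0≤ p≥0 q≥0)

  0≤p*p : ∀ p → 0ℚ ≤ p * p
  0≤p*p p with ≤-total 0ℚ p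
  ... | inj₁ p≥0 = 0≤* p≥0 p≥0
  ... | inj₂ p≤0 = subst (0ℚ ≤_) (neg*neg p) (0≤* (neg-antimono-≤ p≤0) (neg-antimono-≤ p≤0))
    where
    neg*neg : ∀ p → - p * - p ≡ p * p
    neg*neg = solve-∀ ℚ-ring

  *-cancelˡ-≤-0< : ∀ {r p q} → 0ℚ < r → r * p ≤ r * q → p ≤ q
  *-cancelˡ-≤-0< {r} r>0 = *-cancelˡ-≤-pos r {{positive r>0}}

  ≤-by-nonNeg-gap : ∀ {p q} e → 0ℚ ≤ e → p + e ≡ q → p ≤ q
  ≤-by-nonNeg-gap {p} e e≥0 refl = subst (_≤ p + e) (+-identityʳ p) (+-monoʳ-≤ p e≥0)

  -- A total inverse, with the junk value inv 0ℚ = 0ℚ.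
  inv : ℚ → ℚ
  inv p with p ≟ 0ℚ
  ... | yes _ = 0ℚ
  ... | no p≢0 = (1/ p) {{≢-nonZero p≢0}}

  *-inv : ∀ {p} → 0ℚ < p → p * inv p ≡ 1ℚ
  *-inv {p} p>0 with p ≟ 0ℚ
  ... | yes p≡0 = ⊥-elim (<-irrefl (sym p≡0) p>0)
  ... | no p≢0 = *-inverseʳ p {{≢-nonZero p≢0}}

  0≤∧≢0⇒0< : ∀ {p} → 0ℚ ≤ p → p ≢ 0ℚ → 0ℚ < p
  0≤∧≢0⇒0< {p} p≥0 p≢0 = positive⁻¹ p {{nonNeg∧nonZero⇒pos p {{nonNegative p≥0}} {{≢-nonZero p≢0}}}}

  inv-nonNeg : ∀ {p} → 0ℚ ≤ p → 0ℚ ≤ inv p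
  inv-nonNeg {p} p≥0 with p ≟ 0ℚ
  ... | yes _ = ≤-refl
  ... | no p≢0 = <⇒≤ (positive⁻¹ _ {{1/pos⇒pos p {{positive (0≤∧≢0⇒0< p≥0 p≢0)}}}})

  ^-nonNeg : ∀ {p} n → 0ℚ ≤ p → 0ℚ ≤ p ^ n
  ^-nonNeg zero p≥0 = fromℕ-nonNeg 1
  ^-nonNeg (suc n) p≥0 = 0≤* p≥0 (^-nonNeg n p≥0)

  ^-monoˡ-≤ : ∀ {p q} n → 0ℚ ≤ p → p ≤ q → p ^ n ≤ q ^ n
  ^-monoˡ-≤ zero p≥0 p≤q = ≤-refl
  ^-monoˡ-≤ (suc n) p≥0 p≤q = *-mono-≤-0≤ p≥0 (^-nonNeg n p≥0) p≤q (^-monoˡ-≤ n p≥0 p≤q)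

  fromℕ-^ : ∀ m n → fromℕ (m ℕ.^ n) ≡ fromℕ m ^ n
  fromℕ-^ m zero = refl
  fromℕ-^ m (suc n) = trans (fromℕ-* m (m ℕ.^ n)) (cong (fromℕ m *_) (fromℕ-^ m n))

  *-distribˡ-∑ℚ : ∀ {n} p (f : Fin n → ℚ) → p * ∑ℚ f ≡ ∑ℚ (λ i → p * f i)
  *-distribˡ-∑ℚ = Sum.*-distribˡ-sum

  *-distribʳ-∑ℚ : ∀ {n} p (f : Fin n → ℚ) → ∑ℚ f * p ≡ ∑ℚ (λ i → f i * p)
  *-distribʳ-∑ℚ = Sum.*-distribʳ-sum

  ∑ℚ-mono-≤ : ∀ {n} {f g : Fin n → ℚ} → (∀ i → f i ≤ g i) → ∑ℚ f ≤ ∑ℚ g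
  ∑ℚ-mono-≤ {zero} f≤g = ≤-refl
  ∑ℚ-mono-≤ {suc n} f≤g = +-mono-≤ (f≤g zero) (∑ℚ-mono-≤ (f≤g ∘ suc))

  ∑ℚ-nonNeg : ∀ {n} {f : Fin n → ℚ} → (∀ i → 0ℚ ≤ f i) → 0ℚ ≤ ∑ℚ f
  ∑ℚ-nonNeg {zero} f≥0 = ≤-refl
  ∑ℚ-nonNeg {suc n} f≥0 = 0≤+ (f≥0 zero) (∑ℚ-nonNeg (f≥0 ∘ suc))

  ∏ℚ-nonNeg : ∀ {n} {f : Fin n → ℚ} → (∀ i → 0ℚ ≤ f i) → 0ℚ ≤ ∏ℚ f
  ∏ℚ-nonNeg {zero} f≥0 = fromℕ-nonNeg 1
  ∏ℚ-nonNeg {suc n} f≥0 = 0≤* (f≥0 zero) (∏ℚ-nonNeg (f≥0 ∘ suc))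

  ∑ℚ-const : ∀ n p → ∑ℚ {n} (λ _ → p) ≡ fromℕ n * p
  ∑ℚ-const zero p = sym (*-zeroˡ p)
  ∑ℚ-const (suc n) p = begin
    p + ∑ℚ {n} (λ _ → p)  ≡⟨ cong (λ x → p + x) (∑ℚ-const n p) ⟩
    p + fromℕ n * p       ≡⟨ distrib p (fromℕ n) ⟩
    (1ℚ + fromℕ n) * p    ≡⟨ cong (_* p) (fromℕ-suc n) ⟨
    fromℕ (suc n) * p     ∎
    where
    open ≡-Reasoning
    distrib : ∀ p x → p + x * p ≡ (1ℚ + x) * p
    distrib = solve-∀ ℚ-ring

  ∑ℚ-linear : ∀ {n} k₁ k₂ k₃ (f g h : Fin n → ℚ) →
              ∑ℚ (λ i → k₁ * f i + k₂ * g i + k₃ * h i) ≡ k₁ * ∑ℚ f + k₂ * ∑ℚ g + k₃ * ∑ℚ h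
  ∑ℚ-linear k₁ k₂ k₃ f g h = begin
    ∑ℚ (λ i → k₁ * f i + k₂ * g i + k₃ * h i)
      ≡⟨ ∑ℚ-distrib-+ (λ i → k₁ * f i + k₂ * g i) (λ i → k₃ * h i) ⟩
    ∑ℚ (λ i → k₁ * f i + k₂ * g i) + ∑ℚ (λ i → k₃ * h i)
      ≡⟨ cong (_+ ∑ℚ (λ i → k₃ * h i)) (∑ℚ-distrib-+ (λ i → k₁ * f i) (λ i → k₂ * g i)) ⟩
    ∑ℚ (λ i → k₁ * f i) + ∑ℚ (λ i → k₂ * g i) + ∑ℚ (λ i → k₃ * h i)
      ≡⟨ cong₂ _+_ (cong₂ _+_ (*-distribˡ-∑ℚ k₁ f) (*-distribˡ-∑ℚ k₂ g)) (*-distribˡ-∑ℚ k₃ h) ⟨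
    k₁ * ∑ℚ f + k₂ * ∑ℚ g + k₃ * ∑ℚ h ∎
    where open ≡-Reasoning

  fromℕ-∑ : ∀ {n} (f : Fin n → ℕ) → ∑ℚ (fromℕ ∘ f) ≡ fromℕ (∑ f)
  fromℕ-∑ {zero} f = refl
  fromℕ-∑ {suc n} f = trans (cong (fromℕ (f zero) +_) (fromℕ-∑ (f ∘ suc))) (sym (fromℕ-+ (f zero) (∑ (f ∘ suc))))

  fromℕ-∏ : ∀ {n} (f : Fin n → ℕ) → ∏ℚ (fromℕ ∘ f) ≡ fromℕ (∏ f)
  fromℕ-∏ {zero} f = refl
  fromℕ-∏ {suc n} f = trans (cong (fromℕ (f zero) *_) (fromℕ-∏ (f ∘ suc))) (sym (fromℕ-* (f zero) (∏ (f ∘ suc))))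

module AM-GM where
  open import Tactic.RingSolver using (solve-∀)
  open import Data.Nat as ℕ using (ℕ; zero; suc)
  import Data.Nat.Properties as ℕ
  open import Data.Fin using (Fin; zero; suc)
  open import Data.Rational using (ℚ; _+_; _*_; _-_; _≤_; _<_; 0ℚ; 1ℚ)
  open import Data.Rational.Properties using (≤-refl; ≤-reflexive; ≤-trans; +-assoc; *-assoc; +-identityˡ; +-identityʳ; *-identityˡ; *-identityʳ)
  import Data.Rational.Properties
  open import Function using (_∘_)
  open import Relation.Binary.PropositionalEquality
  open NatLemmas using (∑; n^n>0)
  open RationalLemmas

  bernoulli : ∀ p q n → 0ℚ ≤ p → 0ℚ ≤ q → p ^ n * (fromℕ (suc n) * q - fromℕ n * p) ≤ q ^ suc n
  bernoulli p q zero p≥0 q≥0 = ≤-reflexive (base p q)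
    where
    base : ∀ p q → 1ℚ * (1ℚ * q - 0ℚ * p) ≡ q * 1ℚ
    base = solve-∀ ℚ-ring
  bernoulli p q (suc n) p≥0 q≥0 =
    ≤-trans (≤-by-nonNeg-gap _ (0≤* (0≤* (^-nonNeg n p≥0) (fromℕ-nonNeg (suc n))) (0≤p*p (q - p)))
                             (identity (fromℕ-suc n) (fromℕ-suc (suc n))))
            (*-monoˡ-≤-0≤ q≥0 (bernoulli p q n p≥0 q≥0))
    where
    polynomial : ∀ p q z P → p * P * ((1ℚ + (1ℚ + z)) * q - (1ℚ + z) * p) + P * (1ℚ + z) * ((q - p) * (q - p))
                           ≡ q * (P * ((1ℚ + z) * q - z * p))
    polynomial = solve-∀ ℚ-ring
    identity : ∀ {z y x} → y ≡ 1ℚ + z → x ≡ 1ℚ + y →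
               p * p ^ n * (x * q - y * p) + p ^ n * y * ((q - p) * (q - p)) ≡ q * (p ^ n * (y * q - z * p))
    identity {z} refl refl = polynomial p q z (p ^ n)

  -- Bernoulli's inequality at (W + 1) S and W (S + x), divided by W.
  amgm-step : ∀ W S x → 0ℚ ≤ S → 0ℚ ≤ x →
              fromℕ (suc W) ^ suc W * (S ^ W * x) ≤ fromℕ W ^ W * (S + x) ^ suc W
  amgm-step zero S x S≥0 x≥0 = ≤-by-nonNeg-gap S S≥0 (base S x)
    where
    base : ∀ S x → 1ℚ * 1ℚ * (1ℚ * x) + S ≡ 1ℚ * ((S + x) * 1ℚ)
    base = solve-∀ ℚ-ring
  amgm-step (suc V) S x S≥0 x≥0 = *-cancelˡ-≤-0< (fromℕ-pos {W} (ℕ.s≤s ℕ.z≤n)) (subst₂ _≤_ lhs rhs tangent)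
    where
    W : ℕ
    W = suc V
    a w : ℚ
    a = fromℕ (suc W)
    w = fromℕ W
    tangent : (a * S) ^ W * (a * (w * (S + x)) - w * (a * S)) ≤ (w * (S + x)) ^ suc W
    tangent = bernoulli (a * S) (w * (S + x)) W (0≤* (fromℕ-nonNeg (suc W)) S≥0) (0≤* (fromℕ-nonNeg W) (0≤+ S≥0 x≥0))
    lhs-polynomial : ∀ a w S x A Σ → A * Σ * (a * (w * (S + x)) - w * (a * S)) ≡ w * (a * A * (Σ * x))
    lhs-polynomial = solve-∀ ℚ-ring
    lhs : (a * S) ^ W * (a * (w * (S + x)) - w * (a * S)) ≡ w * (a ^ suc W * (S ^ W * x))
    lhs = trans (cong (_* (a * (w * (S + x)) - w * (a * S))) (^-distrib-* a S W)) (lhs-polynomial a w S x (a ^ W) (S ^ W))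
    rhs : (w * (S + x)) ^ suc W ≡ w * (w ^ W * (S + x) ^ suc W)
    rhs = trans (^-distrib-* w (S + x) (suc W)) (*-assoc w (w ^ W) ((S + x) ^ suc W))

  -- The AM–GM inequality (S / W) ^ W ≥ P for W numbers with sum S and product P, without the division.
  record AM≥GM (W : ℕ) (S P : ℚ) : Set where
    constructor am≥gm
    field bound : fromℕ W ^ W * P ≤ S ^ W

  AM≥GM-cong : ∀ {W W′ S S′ P P′} → W ≡ W′ → S ≡ S′ → P ≡ P′ → AM≥GM W S P → AM≥GM W′ S′ P′
  AM≥GM-cong refl refl refl h = h

  AM≥GM-extend : ∀ {W S P x} → 0ℚ ≤ S → 0ℚ ≤ x → AM≥GM W S P → AM≥GM (suc W) (S + x) (P * x)
  AM≥GM-extend {W} {S} {P} {x} S≥0 x≥0 (am≥gm h) = am≥gm (*-cancelˡ-≤-0< (subst (0ℚ <_) (fromℕ-^ W W) (fromℕ-pos (n^n>0 W))) (begin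
    w ^ W * (a ^ suc W * (P * x))  ≡⟨ reassociate (w ^ W) (a ^ suc W) P x ⟩
    a ^ suc W * (w ^ W * P * x)    ≤⟨ *-monoˡ-≤-0≤ (^-nonNeg (suc W) (fromℕ-nonNeg (suc W))) (*-monoʳ-≤-0≤ x≥0 h) ⟩
    a ^ suc W * (S ^ W * x)        ≤⟨ amgm-step W S x S≥0 x≥0 ⟩
    w ^ W * (S + x) ^ suc W        ∎))
    where
    open Data.Rational.Properties.≤-Reasoning
    a w : ℚ
    a = fromℕ (suc W)
    w = fromℕ W
    reassociate : ∀ Ω A P x → Ω * (A * (P * x)) ≡ A * (Ω * P * x)
    reassociate = solve-∀ ℚ-ring

  AM≥GM-extend-copies : ∀ n {W S P x} → 0ℚ ≤ S → 0ℚ ≤ x → AM≥GM W S P →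
                        AM≥GM (W ℕ.+ n) (S + fromℕ n * x) (P * x ^ n)
  AM≥GM-extend-copies zero {W} {S} {P} {x} S≥0 x≥0 h =
    AM≥GM-cong (sym (ℕ.+-identityʳ W)) (no-copies S x) (sym (*-identityʳ P)) h
    where
    no-copies : ∀ S x → S ≡ S + 0ℚ * x
    no-copies = solve-∀ ℚ-ring
  AM≥GM-extend-copies (suc n) {W} {S} {P} {x} S≥0 x≥0 h =
    AM≥GM-cong (sym (ℕ.+-suc W n)) (trans (one-more S (fromℕ n) x) (cong (λ y → S + y * x) (sym (fromℕ-suc n))))
               (one-more-factor P (x ^ n) x)
               (AM≥GM-extend (0≤+ S≥0 (0≤* (fromℕ-nonNeg n) x≥0)) x≥0 (AM≥GM-extend-copies n S≥0 x≥0 h))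
    where
    one-more : ∀ S y x → S + y * x + x ≡ S + (1ℚ + y) * x
    one-more = solve-∀ ℚ-ring
    one-more-factor : ∀ P X x → P * X * x ≡ P * (x * X)
    one-more-factor = solve-∀ ℚ-ring

  AM≥GM-extend-weighted : ∀ {q} (w : Fin q → ℕ) (x : Fin q → ℚ) → (∀ i → 0ℚ ≤ x i) →
                          ∀ {W S P} → 0ℚ ≤ S → AM≥GM W S P →
                          AM≥GM (W ℕ.+ ∑ w) (S + ∑ℚ (λ i → fromℕ (w i) * x i)) (P * ∏ℚ (λ i → x i ^ w i))
  AM≥GM-extend-weighted {zero} w x x≥0 {W} {S} {P} S≥0 h =
    AM≥GM-cong (sym (ℕ.+-identityʳ W)) (sym (+-identityʳ S)) (sym (*-identityʳ P)) h
  AM≥GM-extend-weighted {suc q} w x x≥0 {W} {S} {P} S≥0 h =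
    AM≥GM-cong (ℕ.+-assoc W (w zero) _) (+-assoc S _ _) (*-assoc P _ _)
      (AM≥GM-extend-weighted (w ∘ suc) (x ∘ suc) (x≥0 ∘ suc)
        (0≤+ S≥0 (0≤* (fromℕ-nonNeg (w zero)) (x≥0 zero)))
        (AM≥GM-extend-copies (w zero) S≥0 (x≥0 zero) h))

  amgm-weighted : ∀ {q} (w : Fin q → ℕ) (x : Fin q → ℚ) → (∀ i → 0ℚ ≤ x i) →
                  AM≥GM (∑ w) (∑ℚ (λ i → fromℕ (w i) * x i)) (∏ℚ (λ i → x i ^ w i))
  amgm-weighted w x x≥0 =
    AM≥GM-cong refl (+-identityˡ _) (*-identityˡ _) (AM≥GM-extend-weighted w x x≥0 ≤-refl (am≥gm ≤-refl))

module Decay where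
  open import Data.Nat
  open import Data.Nat.Properties
  open import Data.Nat.Tactic.RingSolver using (solve-∀)
  open import Relation.Binary.PropositionalEquality
  open import Relation.Nullary using (yes; no)
  open NatLemmas

  pred-step : ∀ N → suc N * N ≡ N * pred N + 2 * N
  pred-step zero = refl
  pred-step (suc N) = polynomial N
    where
    polynomial : ∀ N → (2 + N) * (1 + N) ≡ (1 + N) * N + 2 * (1 + N)
    polynomial = solve-∀

  -- (1 + 1/n) ^ N ≥ 1 + N/n + N (N - 1) / (2 n²), multiplied by 2 n² n ^ N.
  binomial-lower-bound : ∀ n N → n ^ N * (2 * n * n + 2 * N * n + N * pred N) ≤ 2 * n * n * suc n ^ N
  binomial-lower-bound n zero = ≤-reflexive (base n)
    where
    base : ∀ n → 1 * (2 * n * n + 2 * 0 * n + 0) ≡ 2 * n * n * 1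
    base = solve-∀
  binomial-lower-bound n (suc N) = begin
    n ^ suc N * (2 * n * n + 2 * suc N * n + suc N * N)
      ≤⟨ m≤m+n _ (n ^ N * (N * pred N)) ⟩
    n ^ suc N * (2 * n * n + 2 * suc N * n + suc N * N) + n ^ N * (N * pred N)
      ≡⟨ cong (λ x → n ^ suc N * (2 * n * n + 2 * suc N * n + x) + n ^ N * (N * pred N)) (pred-step N) ⟩
    n ^ suc N * (2 * n * n + 2 * suc N * n + (N * pred N + 2 * N)) + n ^ N * (N * pred N)
      ≡⟨ polynomial n (n ^ N) (N * pred N) N ⟩
    n ^ N * (2 * n * n + 2 * N * n + N * pred N) * suc n
      ≤⟨ *-monoˡ-≤ (suc n) (binomial-lower-bound n N) ⟩
    2 * n * n * suc n ^ N * suc n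
      ≡⟨ reorder (2 * n * n) (suc n ^ N) (suc n) ⟩
    2 * n * n * suc n ^ suc N ∎
    where
    open ≤-Reasoning
    polynomial : ∀ n P d N → n * P * (2 * n * n + 2 * (1 + N) * n + (d + 2 * N)) + P * d
                           ≡ P * (2 * n * n + 2 * N * n + d) * (1 + n)
    polynomial = solve-∀
    reorder : ∀ a b c → a * b * c ≡ a * (c * b)
    reorder = solve-∀

  five-halves-bound : ∀ n → 5 * n ^ suc n ≤ 2 * suc n ^ suc n
  five-halves-bound zero = z≤n
  five-halves-bound n@(suc _) = *-cancelˡ-≤-pos (n * n) (*-mono-≤ {1} {n} {1} {n} (s≤s z≤n) (s≤s z≤n)) (begin
    n * n * (5 * n ^ suc n)                              ≡⟨ reorder n (n ^ suc n) ⟩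
    n ^ suc n * (5 * n * n)                              ≤⟨ *-monoʳ-≤ (n ^ suc n) (m≤m+n (5 * n * n) (3 * n)) ⟩
    n ^ suc n * (5 * n * n + 3 * n)                      ≡⟨ cong (n ^ suc n *_) (expand n) ⟩
    n ^ suc n * (2 * n * n + 2 * suc n * n + suc n * n)  ≤⟨ binomial-lower-bound n (suc n) ⟩
    2 * n * n * suc n ^ suc n                            ≡⟨ regroup n (suc n ^ suc n) ⟩
    n * n * (2 * suc n ^ suc n)                          ∎)
    where
    open ≤-Reasoning
    reorder : ∀ n a → n * n * (5 * a) ≡ a * (5 * n * n)
    reorder = solve-∀
    expand : ∀ n → 5 * n * n + 3 * n ≡ 2 * n * n + 2 * (1 + n) * n + (1 + n) * n
    expand = solve-∀
    regroup : ∀ n b → 2 * n * n * b ≡ n * n * (2 * b)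
    regroup = solve-∀

  decay-step : ∀ n k → 32 * n ^ ((suc n + k) * 4) ≤ suc n ^ ((suc n + k) * 4)
  decay-step n k = begin
    32 * n ^ ((suc n + k) * 4)             ≡⟨ cong (λ x → 32 * n ^ x) (*-distribʳ-+ 4 (suc n) k) ⟩
    32 * n ^ (suc n * 4 + k * 4)           ≡⟨ cong (32 *_) (^-distribˡ-+-* n (suc n * 4) (k * 4)) ⟩
    32 * (n ^ (suc n * 4) * n ^ (k * 4))   ≡⟨ *-assoc 32 (n ^ (suc n * 4)) (n ^ (k * 4)) ⟨
    32 * n ^ (suc n * 4) * n ^ (k * 4)     ≤⟨ *-mono-≤ full-period (^-monoˡ-≤ (k * 4) (n≤1+n n)) ⟩
    suc n ^ (suc n * 4) * suc n ^ (k * 4)  ≡⟨ ^-distribˡ-+-* (suc n) (suc n * 4) (k * 4) ⟨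
    suc n ^ (suc n * 4 + k * 4)            ≡⟨ cong (suc n ^_) (*-distribʳ-+ 4 (suc n) k) ⟨
    suc n ^ ((suc n + k) * 4)              ∎
    where
    open ≤-Reasoning
    full-period : 32 * n ^ (suc n * 4) ≤ suc n ^ (suc n * 4)
    full-period = *-cancelˡ-≤-pos 16 (s≤s z≤n) (begin
      16 * (32 * n ^ (suc n * 4))  ≡⟨ *-assoc 16 32 (n ^ (suc n * 4)) ⟨
      512 * n ^ (suc n * 4)        ≤⟨ *-monoˡ-≤ (n ^ (suc n * 4)) (m≤m+n 512 113) ⟩
      625 * n ^ (suc n * 4)        ≡⟨ cong (625 *_) (^-*-assoc n (suc n) 4) ⟨
      625 * (n ^ suc n) ^ 4        ≡⟨ ^-distribʳ-* 5 (n ^ suc n) 4 ⟨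
      (5 * n ^ suc n) ^ 4          ≤⟨ ^-monoˡ-≤ 4 (five-halves-bound n) ⟩
      (2 * suc n ^ suc n) ^ 4      ≡⟨ ^-distribʳ-* 2 (suc n ^ suc n) 4 ⟩
      16 * (suc n ^ suc n) ^ 4     ≡⟨ cong (16 *_) (^-*-assoc (suc n) (suc n) 4) ⟩
      16 * suc n ^ (suc n * 4)     ∎)

  -- (1 - s/v) ^ (4v) ≤ 2 ^ (-5s), from (1 + 1/n) ^ (n + 1) ≥ 5/2.
  decay : ∀ s v → 0 < v → 32 ^ s * (v ∸ s) ^ (v * 4) ≤ v ^ (v * 4)
  decay zero v v>0 = ≤-reflexive (+-identityʳ _)
  decay (suc s) v v>0 with suc s ≤? v
  ... | yes s<v = begin
    32 ^ suc s * (v ∸ suc s) ^ (v * 4)     ≡⟨ *-assoc 32 (32 ^ s) _ ⟩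
    32 * (32 ^ s * (v ∸ suc s) ^ (v * 4))  ≡⟨ x*[y*z]≡y*[x*z] 32 (32 ^ s) _ ⟩
    32 ^ s * (32 * (v ∸ suc s) ^ (v * 4))  ≤⟨ *-monoʳ-≤ (32 ^ s) one-step ⟩
    32 ^ s * (v ∸ s) ^ (v * 4)             ≤⟨ decay s v v>0 ⟩
    v ^ (v * 4)                            ∎
    where
    open ≤-Reasoning
    n : ℕ
    n = v ∸ suc s
    v∸s≡1+n : v ∸ s ≡ suc n
    v∸s≡1+n = +-∸-assoc 1 s<v
    v≡1+n+s : v ≡ suc n + s
    v≡1+n+s = trans (sym (m∸n+n≡m (≤-trans (n≤1+n s) s<v))) (cong (_+ s) v∸s≡1+n)
    one-step : 32 * n ^ (v * 4) ≤ (v ∸ s) ^ (v * 4)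
    one-step = subst₂ (λ a z → 32 * n ^ (z * 4) ≤ a ^ (z * 4)) (sym v∸s≡1+n) (sym v≡1+n+s) (decay-step n s)
  ... | no s≮v rewrite m≤n⇒m∸n≡0 (<⇒≤ (≰⇒> s≮v)) = vanishing v v>0
    where
    vanishing : ∀ v → 0 < v → 32 ^ suc s * 0 ^ (v * 4) ≤ v ^ (v * 4)
    vanishing (suc v) _ rewrite *-zeroʳ (32 ^ suc s) = z≤n

module Interpolation where
  open import Tactic.RingSolver using (solve-∀)
  open import Data.Nat as ℕ using (ℕ; zero; suc)
  import Data.Nat.Properties as ℕ
  open import Data.Fin using (Fin; zero; suc)
  open import Data.Rational using (ℚ; _+_; _*_; _-_; -_; _≤_; _<_; 0ℚ; 1ℚ; ∣_∣)
  open import Data.Rational.Properties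
    using (≤-reflexive; ≤-trans; <-≤-trans; _≟_; +-identityˡ; ∣-p∣≡∣p∣; 0≤p⇒∣p∣≡p; ∣p*q∣≡∣p∣*∣q∣)
  import Data.Rational.Properties
  open import Function using (_∘_)
  open import Relation.Binary.PropositionalEquality
  open import Relation.Nullary using (yes; no)
  open import Data.Product using (Σ; _,_; proj₁; proj₂)
  open RationalLemmas

  ∣p∣*∣p∣ : ∀ p → ∣ p ∣ * ∣ p ∣ ≡ p * p
  ∣p∣*∣p∣ p = trans (sym (∣p*q∣≡∣p∣*∣q∣ p p)) (0≤p⇒∣p∣≡p (0≤p*p p))

  ≤-interpolant : ∀ {p r t s} → 0ℚ ≤ p → 0ℚ ≤ r → 0ℚ ≤ t → 0ℚ ≤ s → p ≤ t * r + (1ℚ + s) * p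
  ≤-interpolant {p} {r} {t} {s} p≥0 r≥0 t≥0 s≥0 =
    ≤-by-nonNeg-gap (t * r + s * p) (0≤+ (0≤* t≥0 r≥0) (0≤* s≥0 p≥0)) (split p r t s)
    where
    split : ∀ p r t s → p + (t * r + s * p) ≡ t * r + (1ℚ + s) * p
    split = solve-∀ ℚ-ring

  ratio-gap : ∀ {p r t s U} a b → U ≡ t * r + (1ℚ + s) * p → U * inv U ≡ 1ℚ →
    U * ((1ℚ + t + s) * (b * b) * (p * ((U + (r - p)) * inv U))) + t * ((b * ∣ p - r ∣ - a * U) * (b * ∣ p - r ∣ - a * U))
      ≡ U * (b * b * ((t + s) * p + r) - t * (fromℕ 2 * a * b * ∣ p - r ∣ - a * a * U))
  ratio-gap {p} {r} {t} {s} a b refl U*U⁻¹≡1 = begin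
    U * (n * (b * b) * (p * ((U + (r - p)) * inv U))) + t * (g * g)
      ≡⟨ cong (_+ t * (g * g)) (regroup U (n * (b * b)) p (U + (r - p)) (inv U)) ⟩
    n * (b * b) * (p * (U + (r - p))) * (U * inv U) + t * (g * g)
      ≡⟨ cong (λ z → n * (b * b) * (p * (U + (r - p))) * z + t * (g * g)) U*U⁻¹≡1 ⟩
    n * (b * b) * (p * (U + (r - p))) * 1ℚ + t * (g * g)
      ≡⟨ polynomial p r t s a b E ⟩
    U * RHS + t * (b * b) * (E * E - (p - r) * (p - r))
      ≡⟨ cong (λ z → U * RHS + t * (b * b) * (z - (p - r) * (p - r))) (∣p∣*∣p∣ (p - r)) ⟩
    U * RHS + t * (b * b) * ((p - r) * (p - r) - (p - r) * (p - r))
      ≡⟨ vanish (U * RHS) (t * (b * b)) ((p - r) * (p - r)) ⟩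
    U * RHS ∎
    where
    open ≡-Reasoning
    n U E g RHS : ℚ
    n = 1ℚ + t + s
    U = t * r + (1ℚ + s) * p
    E = ∣ p - r ∣
    g = b * E - a * U
    RHS = b * b * ((t + s) * p + r) - t * (fromℕ 2 * a * b * E - a * a * U)
    regroup : ∀ U C p Y V → U * (C * (p * (Y * V))) ≡ C * (p * Y) * (U * V)
    regroup = solve-∀ ℚ-ring
    polynomial : ∀ p r t s a b E →
      (1ℚ + t + s) * (b * b) * (p * (t * r + (1ℚ + s) * p + (r - p))) * 1ℚ
        + t * ((b * E - a * (t * r + (1ℚ + s) * p)) * (b * E - a * (t * r + (1ℚ + s) * p)))
      ≡ (t * r + (1ℚ + s) * p) * (b * b * ((t + s) * p + r) - t * (fromℕ 2 * a * b * E - a * a * (t * r + (1ℚ + s) * p)))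
        + t * (b * b) * (E * E - (p - r) * (p - r))
    polynomial = solve-∀ ℚ-ring
    vanish : ∀ x y z → x + y * (z - z) ≡ x
    vanish = solve-∀ ℚ-ring

  -- U + (r - p) is the point after U on the path from p to r, so the left side weighs the ratio of two
  -- consecutive points.
  ratio-bound : ∀ {p r t s U} a b → 0ℚ ≤ p → 0ℚ ≤ r → 0ℚ ≤ t → 0ℚ ≤ s → U ≡ t * r + (1ℚ + s) * p →
                (1ℚ + t + s) * (b * b) * (p * ((U + (r - p)) * inv U))
                  ≤ b * b * ((t + s) * p + r) - t * (fromℕ 2 * a * b * ∣ p - r ∣ - a * a * U)
  ratio-bound {p} {r} {t} {s} a b p≥0 r≥0 t≥0 s≥0 refl with p ≟ 0ℚ
  ... | yes refl = ≤-by-nonNeg-gap _ (0≤* r≥0 (0≤p*p (b - t * a))) (trans (at-zero r t s a b X) (cong rhs r≡∣0-r∣))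
    where
    X : ℚ
    X = (t * r + (1ℚ + s) * 0ℚ + (r - 0ℚ)) * inv (t * r + (1ℚ + s) * 0ℚ)
    rhs : ℚ → ℚ
    rhs e = b * b * ((t + s) * 0ℚ + r) - t * (fromℕ 2 * a * b * e - a * a * (t * r + (1ℚ + s) * 0ℚ))
    r≡∣0-r∣ : r ≡ ∣ 0ℚ - r ∣
    r≡∣0-r∣ = sym (trans (cong ∣_∣ (+-identityˡ (- r))) (trans (∣-p∣≡∣p∣ r) (0≤p⇒∣p∣≡p r≥0)))
    at-zero : ∀ r t s a b X → (1ℚ + t + s) * (b * b) * (0ℚ * X) + r * ((b - t * a) * (b - t * a))
                             ≡ b * b * ((t + s) * 0ℚ + r) - t * (fromℕ 2 * a * b * r - a * a * (t * r + (1ℚ + s) * 0ℚ))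
    at-zero = solve-∀ ℚ-ring
  ... | no p≢0 =
    *-cancelˡ-≤-0< U>0 (≤-by-nonNeg-gap (t * (g * g)) (0≤* t≥0 (0≤p*p g)) (ratio-gap {p} {r} {t} {s} a b refl (*-inv U>0)))
    where
    g : ℚ
    g = b * ∣ p - r ∣ - a * (t * r + (1ℚ + s) * p)
    U>0 : 0ℚ < t * r + (1ℚ + s) * p
    U>0 = <-≤-trans (0≤∧≢0⇒0< p≥0 p≢0) (≤-interpolant p≥0 r≥0 t≥0 s≥0)

  -- As ∸ truncates, the witness is α when 2αβA ≥ α²T and 0 otherwise.
  quadratic-witness : ∀ α β A T →
    Σ ℚ λ a → fromℕ 2 * a * fromℕ β * fromℕ A - a * a * fromℕ T ≡ fromℕ (2 ℕ.* α ℕ.* β ℕ.* A ℕ.∸ α ℕ.* α ℕ.* T)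
  quadratic-witness α β A T with α ℕ.* α ℕ.* T ℕ.≤? 2 ℕ.* α ℕ.* β ℕ.* A
  ... | yes le = fromℕ α , sym (begin
    fromℕ (2 ℕ.* α ℕ.* β ℕ.* A ℕ.∸ α ℕ.* α ℕ.* T)                        ≡⟨ fromℕ-∸ le ⟩
    fromℕ (2 ℕ.* α ℕ.* β ℕ.* A) - fromℕ (α ℕ.* α ℕ.* T)                  ≡⟨ cong₂ _-_ (fromℕ-*⁴ 2 α β A) (fromℕ-*³ α α T) ⟩
    fromℕ 2 * fromℕ α * fromℕ β * fromℕ A - fromℕ α * fromℕ α * fromℕ T  ∎)
    where
    open ≡-Reasoning
    fromℕ-*³ : ∀ x y z → fromℕ (x ℕ.* y ℕ.* z) ≡ fromℕ x * fromℕ y * fromℕ z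
    fromℕ-*³ x y z = trans (fromℕ-* (x ℕ.* y) z) (cong (_* fromℕ z) (fromℕ-* x y))
    fromℕ-*⁴ : ∀ w x y z → fromℕ (w ℕ.* x ℕ.* y ℕ.* z) ≡ fromℕ w * fromℕ x * fromℕ y * fromℕ z
    fromℕ-*⁴ w x y z = trans (fromℕ-* (w ℕ.* x ℕ.* y) z) (cong (_* fromℕ z) (fromℕ-*³ w x y))
  ... | no gt = 0ℚ , trans (vanish (fromℕ β) (fromℕ A) (fromℕ T))
                           (cong fromℕ (sym (ℕ.m≤n⇒m∸n≡0 (ℕ.<⇒≤ (ℕ.≰⇒> gt)))))
    where
    vanish : ∀ B A T → fromℕ 2 * 0ℚ * B * A - 0ℚ * 0ℚ * T ≡ 0ℚ
    vanish = solve-∀ ℚ-ring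

  module Path {q} (c C : Fin q → ℕ) {m M : ℕ} (∑c≡m : NatLemmas.∑ c ≡ m) (∑C≡M : NatLemmas.∑ C ≡ M) (M>0 : 0 ℕ.< M) where
    open NatLemmas using (∑; ∏; ∑-cong; *-distribˡ-∑)

    T A : ℕ
    T = m ℕ.* M
    A = ∑ (λ i → ℕ.∣ c i ℕ.* M - C i ℕ.* m ∣)

    -- Point t ≤ 5 of the straight path from 5 (c i M) to 5 (C i m); every point has total 5 T.
    mix : ℕ → Fin q → ℕ
    mix t i = t ℕ.* (C i ℕ.* m) ℕ.+ (5 ℕ.∸ t) ℕ.* (c i ℕ.* M)

    p r : Fin q → ℚ
    p i = fromℕ (c i ℕ.* M)
    r i = fromℕ (C i ℕ.* m)

    ∑cM≡T : ∑ (λ i → c i ℕ.* M) ≡ T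
    ∑cM≡T = begin
      ∑ (λ i → c i ℕ.* M)  ≡⟨ ∑-cong (λ i → ℕ.*-comm (c i) M) ⟩
      ∑ (λ i → M ℕ.* c i)  ≡⟨ *-distribˡ-∑ M c ⟨
      M ℕ.* ∑ c            ≡⟨ cong (M ℕ.*_) ∑c≡m ⟩
      M ℕ.* m              ≡⟨ ℕ.*-comm M m ⟩
      T                    ∎
      where open ≡-Reasoning

    ∑Cm≡T : ∑ (λ i → C i ℕ.* m) ≡ T
    ∑Cm≡T = begin
      ∑ (λ i → C i ℕ.* m)  ≡⟨ ∑-cong (λ i → ℕ.*-comm (C i) m) ⟩
      ∑ (λ i → m ℕ.* C i)  ≡⟨ *-distribˡ-∑ m C ⟨
      m ℕ.* ∑ C            ≡⟨ cong (m ℕ.*_) ∑C≡M ⟩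
      T                    ∎
      where open ≡-Reasoning

    ∑p≡T : ∑ℚ p ≡ fromℕ T
    ∑p≡T = trans (fromℕ-∑ (λ i → c i ℕ.* M)) (cong fromℕ ∑cM≡T)

    ∑r≡T : ∑ℚ r ≡ fromℕ T
    ∑r≡T = trans (fromℕ-∑ (λ i → C i ℕ.* m)) (cong fromℕ ∑Cm≡T)

    ∑∣p-r∣≡A : ∑ℚ (λ i → ∣ p i - r i ∣) ≡ fromℕ A
    ∑∣p-r∣≡A = trans (∑ℚ-cong {q} (λ i → ∣fromℕ-fromℕ∣ (c i ℕ.* M) (C i ℕ.* m)))
                     (fromℕ-∑ (λ i → ℕ.∣ c i ℕ.* M - C i ℕ.* m ∣))

    v : ℕ → ℕ
    v β = 25 ℕ.* (β ℕ.* β) ℕ.* T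

    u : ℕ → ℕ → ℕ
    u α β = 2 ℕ.* α ℕ.* β ℕ.* A ℕ.∸ α ℕ.* α ℕ.* T

    module Step (t : ℕ) (t≤4 : t ℕ.≤ 4) where
      τ σ : ℚ
      τ = fromℕ t
      σ = fromℕ (4 ℕ.∸ t)

      U x : Fin q → ℚ
      U i = fromℕ (mix t i)
      x i = fromℕ (mix (suc t) i) * inv (U i)

      U≡ : ∀ i → U i ≡ τ * r i + (1ℚ + σ) * p i
      U≡ i = begin
        fromℕ (t ℕ.* (C i ℕ.* m) ℕ.+ (5 ℕ.∸ t) ℕ.* (c i ℕ.* M))        ≡⟨ fromℕ-+ (t ℕ.* (C i ℕ.* m)) _ ⟩
        fromℕ (t ℕ.* (C i ℕ.* m)) + fromℕ ((5 ℕ.∸ t) ℕ.* (c i ℕ.* M))  ≡⟨ cong₂ _+_ (fromℕ-* t (C i ℕ.* m)) (fromℕ-* (5 ℕ.∸ t) (c i ℕ.* M)) ⟩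
        τ * r i + fromℕ (5 ℕ.∸ t) * p i                                ≡⟨ cong (λ y → τ * r i + fromℕ y * p i) (ℕ.+-∸-assoc 1 t≤4) ⟩
        τ * r i + fromℕ (suc (4 ℕ.∸ t)) * p i                          ≡⟨ cong (λ y → τ * r i + y * p i) (fromℕ-suc (4 ℕ.∸ t)) ⟩
        τ * r i + (1ℚ + σ) * p i                                       ∎
        where open ≡-Reasoning

      next≡ : ∀ i → fromℕ (mix (suc t) i) ≡ U i + (r i - p i)
      next≡ i = begin
        fromℕ (suc t ℕ.* (C i ℕ.* m) ℕ.+ (4 ℕ.∸ t) ℕ.* (c i ℕ.* M))
          ≡⟨ fromℕ-+ (suc t ℕ.* (C i ℕ.* m)) _ ⟩
        fromℕ (suc t ℕ.* (C i ℕ.* m)) + fromℕ ((4 ℕ.∸ t) ℕ.* (c i ℕ.* M))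
          ≡⟨ cong₂ _+_ (fromℕ-* (suc t) (C i ℕ.* m)) (fromℕ-* (4 ℕ.∸ t) (c i ℕ.* M)) ⟩
        fromℕ (suc t) * r i + σ * p i
          ≡⟨ cong (λ y → y * r i + σ * p i) (fromℕ-suc t) ⟩
        (1ℚ + τ) * r i + σ * p i
          ≡⟨ shift τ σ (r i) (p i) ⟩
        τ * r i + (1ℚ + σ) * p i + (r i - p i)
          ≡⟨ cong (_+ (r i - p i)) (U≡ i) ⟨
        U i + (r i - p i) ∎
        where
        open ≡-Reasoning
        shift : ∀ τ σ r p → (1ℚ + τ) * r + σ * p ≡ τ * r + (1ℚ + σ) * p + (r - p)
        shift = solve-∀ ℚ-ring

      x≥0 : ∀ i → 0ℚ ≤ x i
      x≥0 i = 0≤* (fromℕ-nonNeg (mix (suc t) i)) (inv-nonNeg (fromℕ-nonNeg (mix t i)))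

      summed-ratio-bound : ∀ a b →
        (1ℚ + τ + σ) * (b * b) * ∑ℚ (λ i → p i * x i)
          ≤ b * b * ((1ℚ + τ + σ) * fromℕ T) - τ * (fromℕ 2 * a * b * fromℕ A - a * a * ((1ℚ + τ + σ) * fromℕ T))
      summed-ratio-bound a b = begin
        n * (b * b) * ∑ℚ (λ i → p i * x i)
          ≡⟨ *-distribˡ-∑ℚ (n * (b * b)) (λ i → p i * x i) ⟩
        ∑ℚ (λ i → n * (b * b) * (p i * x i))
          ≡⟨ ∑ℚ-cong {q} (λ i → cong (λ y → n * (b * b) * (p i * (y * inv (U i)))) (next≡ i)) ⟩
        ∑ℚ (λ i → n * (b * b) * (p i * ((U i + (r i - p i)) * inv (U i))))
          ≤⟨ ∑ℚ-mono-≤ (λ i → ratio-bound a b (fromℕ-nonNeg _) (fromℕ-nonNeg _) (fromℕ-nonNeg t) (fromℕ-nonNeg (4 ℕ.∸ t)) (U≡ i)) ⟩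
        ∑ℚ (λ i → b * b * ((τ + σ) * p i + r i) - τ * (fromℕ 2 * a * b * ∣ p i - r i ∣ - a * a * U i))
          ≡⟨ ∑ℚ-cong {q} (λ i → trans (cong (λ y → b * b * ((τ + σ) * p i + r i) - τ * (fromℕ 2 * a * b * ∣ p i - r i ∣ - a * a * y)) (U≡ i))
                                       (linear a b τ σ (p i) (r i) ∣ p i - r i ∣)) ⟩
        ∑ℚ (λ i → k₁ * p i + k₂ * r i + k₃ * ∣ p i - r i ∣)
          ≡⟨ ∑ℚ-linear k₁ k₂ k₃ p r (λ i → ∣ p i - r i ∣) ⟩
        k₁ * ∑ℚ p + k₂ * ∑ℚ r + k₃ * ∑ℚ (λ i → ∣ p i - r i ∣)
          ≡⟨ cong₂ _+_ (cong₂ _+_ (cong (k₁ *_) ∑p≡T) (cong (k₂ *_) ∑r≡T)) (cong (k₃ *_) ∑∣p-r∣≡A) ⟩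
        k₁ * fromℕ T + k₂ * fromℕ T + k₃ * fromℕ A
          ≡⟨ total a b τ σ (fromℕ T) (fromℕ A) ⟩
        b * b * (n * fromℕ T) - τ * (fromℕ 2 * a * b * fromℕ A - a * a * (n * fromℕ T)) ∎
        where
        open Data.Rational.Properties.≤-Reasoning
        n k₁ k₂ k₃ : ℚ
        n = 1ℚ + τ + σ
        k₁ = b * b * (τ + σ) + τ * (a * a) * (1ℚ + σ)
        k₂ = b * b + τ * (a * a) * τ
        k₃ = - (τ * fromℕ 2 * a * b)
        linear : ∀ a b τ σ p r E →
          b * b * ((τ + σ) * p + r) - τ * (fromℕ 2 * a * b * E - a * a * (τ * r + (1ℚ + σ) * p))
            ≡ (b * b * (τ + σ) + τ * (a * a) * (1ℚ + σ)) * p + (b * b + τ * (a * a) * τ) * r + - (τ * fromℕ 2 * a * b) * E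
        linear = solve-∀ ℚ-ring
        total : ∀ a b τ σ T A →
          (b * b * (τ + σ) + τ * (a * a) * (1ℚ + σ)) * T + (b * b + τ * (a * a) * τ) * T + - (τ * fromℕ 2 * a * b) * A
            ≡ b * b * ((1ℚ + τ + σ) * T) - τ * (fromℕ 2 * a * b * A - a * a * ((1ℚ + τ + σ) * T))
        total = solve-∀ ℚ-ring

      scaled-ratio-bound : ∀ α β → fromℕ (25 ℕ.* (β ℕ.* β)) * ∑ℚ (λ i → p i * x i) ≤ fromℕ (v β ℕ.∸ t ℕ.* u α β)
      scaled-ratio-bound α β = *-cancelˡ-≤-0< (fromℕ-pos {5} (ℕ.s≤s ℕ.z≤n)) (begin
        fromℕ 5 * (fromℕ (25 ℕ.* (β ℕ.* β)) * Σpx)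
          ≡⟨ cong (λ y → fromℕ 5 * (y * Σpx)) (trans (fromℕ-* 25 (β ℕ.* β)) (cong (fromℕ 25 *_) (fromℕ-* β β))) ⟩
        fromℕ 5 * (fromℕ 25 * (B * B) * Σpx)
          ≡⟨ left-side B Σpx ⟩
        fromℕ 5 * (b * b) * Σpx
          ≡⟨ cong (λ n → n * (b * b) * Σpx) n≡5 ⟨
        (1ℚ + τ + σ) * (b * b) * Σpx
          ≤⟨ summed-ratio-bound a b ⟩
        b * b * ((1ℚ + τ + σ) * fromℕ T) - τ * (fromℕ 2 * a * b * fromℕ A - a * a * ((1ℚ + τ + σ) * fromℕ T))
          ≡⟨ cong (λ n → b * b * (n * fromℕ T) - τ * (fromℕ 2 * a * b * fromℕ A - a * a * (n * fromℕ T))) n≡5 ⟩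
        b * b * (fromℕ 5 * fromℕ T) - τ * (fromℕ 2 * a * b * fromℕ A - a * a * (fromℕ 5 * fromℕ T))
          ≡⟨ right-side a B τ (fromℕ T) (fromℕ A) ⟩
        fromℕ 5 * (fromℕ 25 * (B * B) * fromℕ T - τ * (fromℕ 2 * a * B * fromℕ A - a * a * fromℕ T))
          ≡⟨ cong₂ (λ y z → fromℕ 5 * (y - τ * z)) v≡ (proj₂ (quadratic-witness α β A T)) ⟩
        fromℕ 5 * (fromℕ (v β) - τ * fromℕ (u α β))
          ≡⟨ cong (λ y → fromℕ 5 * (fromℕ (v β) - y)) (fromℕ-* t (u α β)) ⟨
        fromℕ 5 * (fromℕ (v β) - fromℕ (t ℕ.* u α β))
          ≤⟨ *-monoˡ-≤-0≤ (fromℕ-nonNeg 5) (fromℕ-∸-≥ (v β) (t ℕ.* u α β)) ⟩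
        fromℕ 5 * fromℕ (v β ℕ.∸ t ℕ.* u α β) ∎)
        where
        open Data.Rational.Properties.≤-Reasoning
        Σpx B b a : ℚ
        Σpx = ∑ℚ (λ i → p i * x i)
        B = fromℕ β
        b = fromℕ 5 * B
        a = proj₁ (quadratic-witness α β A T)
        n≡5 : 1ℚ + τ + σ ≡ fromℕ 5
        n≡5 = begin-equality
          1ℚ + τ + σ                     ≡⟨ Data.Rational.Properties.+-assoc 1ℚ τ σ ⟩
          1ℚ + (τ + σ)                   ≡⟨ cong (1ℚ +_) (fromℕ-+ t (4 ℕ.∸ t)) ⟨
          1ℚ + fromℕ (t ℕ.+ (4 ℕ.∸ t))   ≡⟨ fromℕ-suc (t ℕ.+ (4 ℕ.∸ t)) ⟨
          fromℕ (suc (t ℕ.+ (4 ℕ.∸ t)))  ≡⟨ cong (fromℕ ∘ suc) (ℕ.m+[n∸m]≡n t≤4) ⟩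
          fromℕ 5                        ∎
        v≡ : fromℕ 25 * (B * B) * fromℕ T ≡ fromℕ (v β)
        v≡ = sym (trans (fromℕ-* (25 ℕ.* (β ℕ.* β)) T)
                        (cong (_* fromℕ T) (trans (fromℕ-* 25 (β ℕ.* β)) (cong (fromℕ 25 *_) (fromℕ-* β β)))))
        left-side : ∀ B S → fromℕ 5 * (fromℕ 25 * (B * B) * S) ≡ fromℕ 5 * ((fromℕ 5 * B) * (fromℕ 5 * B)) * S
        left-side = solve-∀ ℚ-ring
        right-side : ∀ a B τ T A →
          (fromℕ 5 * B) * (fromℕ 5 * B) * (fromℕ 5 * T) - τ * (fromℕ 2 * a * (fromℕ 5 * B) * A - a * a * (fromℕ 5 * T))
            ≡ fromℕ 5 * (fromℕ 25 * (B * B) * T - τ * (fromℕ 2 * a * B * A - a * a * T))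
        right-side = solve-∀ ℚ-ring

      mix-factor : ∀ i → fromℕ (mix (suc t) i) ^ c i ≡ x i ^ c i * U i ^ c i
      mix-factor i = factor (c i) refl
        where
        factor : ∀ k → c i ≡ k → fromℕ (mix (suc t) i) ^ k ≡ x i ^ k * U i ^ k
        factor zero _ = refl
        factor (suc k) c≡1+k = trans (cong (_^ suc k) (sym x*U≡)) (^-distrib-* (x i) (U i) (suc k))
          where
          p>0 : 0ℚ < p i
          p>0 = fromℕ-pos (subst (λ y → 0 ℕ.< y ℕ.* M) (sym c≡1+k) (ℕ.*-mono-≤ (ℕ.s≤s (ℕ.z≤n {k})) M>0))
          U>0 : 0ℚ < U i
          U>0 = <-≤-trans p>0 (subst (p i ≤_) (sym (U≡ i))
                  (≤-interpolant (fromℕ-nonNeg _) (fromℕ-nonNeg _) (fromℕ-nonNeg t) (fromℕ-nonNeg (4 ℕ.∸ t))))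
          x*U≡ : x i * U i ≡ fromℕ (mix (suc t) i)
          x*U≡ = trans (Data.Rational.Properties.*-assoc (fromℕ (mix (suc t) i)) (inv (U i)) (U i))
                   (trans (cong (fromℕ (mix (suc t) i) *_) (trans (Data.Rational.Properties.*-comm (inv (U i)) (U i)) (*-inv U>0)))
                          (Data.Rational.Properties.*-identityʳ (fromℕ (mix (suc t) i))))

      S : ℚ
      S = ∑ℚ (λ i → fromℕ (c i) * x i)

      amgm-bound : fromℕ m ^ m * ∏ℚ (λ i → x i ^ c i) ≤ S ^ m
      amgm-bound = subst (λ W → fromℕ W ^ W * ∏ℚ (λ i → x i ^ c i) ≤ S ^ W) ∑c≡m (AM-GM.AM≥GM.bound (AM-GM.amgm-weighted c x x≥0))

      M*S≡∑px : fromℕ M * S ≡ ∑ℚ (λ i → p i * x i)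
      M*S≡∑px = trans (*-distribˡ-∑ℚ (fromℕ M) (λ i → fromℕ (c i) * x i))
                      (∑ℚ-cong {q} (λ i → trans (regroup (fromℕ M) (fromℕ (c i)) (x i)) (cong (_* x i) (sym (fromℕ-* (c i) M)))))
        where
        regroup : ∀ M c x → M * (c * x) ≡ c * M * x
        regroup = solve-∀ ℚ-ring

      step-ℚ : ∀ α β → fromℕ (v β) ^ m * ∏ℚ (λ i → fromℕ (mix (suc t) i) ^ c i)
                          ≤ fromℕ (v β ℕ.∸ t ℕ.* u α β) ^ m * ∏ℚ (λ i → U i ^ c i)
      step-ℚ α β = begin
        fromℕ (v β) ^ m * ∏ℚ (λ i → fromℕ (mix (suc t) i) ^ c i)
          ≡⟨ cong₂ (λ y z → y ^ m * z) v≡K*m (trans (∏ℚ-cong {q} mix-factor) (∏ℚ-distrib-* (λ i → x i ^ c i) (λ i → U i ^ c i))) ⟩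
        (K * fromℕ m) ^ m * (∏x * ∏U)
          ≡⟨ cong (_* (∏x * ∏U)) (^-distrib-* K (fromℕ m) m) ⟩
        K ^ m * fromℕ m ^ m * (∏x * ∏U)
          ≡⟨ regroup (K ^ m) (fromℕ m ^ m) ∏x ∏U ⟩
        K ^ m * (fromℕ m ^ m * ∏x) * ∏U
          ≤⟨ *-monoʳ-≤-0≤ (∏ℚ-nonNeg (λ i → ^-nonNeg (c i) (fromℕ-nonNeg (mix t i))))
               (*-monoˡ-≤-0≤ (^-nonNeg m K≥0) amgm-bound) ⟩
        K ^ m * S ^ m * ∏U
          ≡⟨ cong (_* ∏U) (^-distrib-* K S m) ⟨
        (K * S) ^ m * ∏U
          ≤⟨ *-monoʳ-≤-0≤ (∏ℚ-nonNeg (λ i → ^-nonNeg (c i) (fromℕ-nonNeg (mix t i))))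
               (^-monoˡ-≤ m (0≤* K≥0 (∑ℚ-nonNeg (λ i → 0≤* (fromℕ-nonNeg (c i)) (x≥0 i))))
                 (≤-trans (≤-reflexive K*S≡) (scaled-ratio-bound α β))) ⟩
        fromℕ (v β ℕ.∸ t ℕ.* u α β) ^ m * ∏U ∎
        where
        open Data.Rational.Properties.≤-Reasoning
        K ∏x ∏U : ℚ
        K = fromℕ (25 ℕ.* (β ℕ.* β)) * fromℕ M
        ∏x = ∏ℚ (λ i → x i ^ c i)
        ∏U = ∏ℚ (λ i → U i ^ c i)
        K≥0 : 0ℚ ≤ K
        K≥0 = 0≤* (fromℕ-nonNeg (25 ℕ.* (β ℕ.* β))) (fromℕ-nonNeg M)
        v≡K*m : fromℕ (v β) ≡ K * fromℕ m
        v≡K*m = begin-equality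
          fromℕ (25 ℕ.* (β ℕ.* β) ℕ.* (m ℕ.* M))
            ≡⟨ fromℕ-* (25 ℕ.* (β ℕ.* β)) (m ℕ.* M) ⟩
          fromℕ (25 ℕ.* (β ℕ.* β)) * fromℕ (m ℕ.* M)
            ≡⟨ cong (fromℕ (25 ℕ.* (β ℕ.* β)) *_) (trans (fromℕ-* m M) (Data.Rational.Properties.*-comm (fromℕ m) (fromℕ M))) ⟩
          fromℕ (25 ℕ.* (β ℕ.* β)) * (fromℕ M * fromℕ m)
            ≡⟨ Data.Rational.Properties.*-assoc (fromℕ (25 ℕ.* (β ℕ.* β))) (fromℕ M) (fromℕ m) ⟨
          K * fromℕ m ∎
        K*S≡ : K * S ≡ fromℕ (25 ℕ.* (β ℕ.* β)) * ∑ℚ (λ i → p i * x i)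
        K*S≡ = trans (Data.Rational.Properties.*-assoc (fromℕ (25 ℕ.* (β ℕ.* β))) (fromℕ M) S)
                     (cong (fromℕ (25 ℕ.* (β ℕ.* β)) *_) M*S≡∑px)
        regroup : ∀ a b c d → a * b * (c * d) ≡ a * (b * c) * d
        regroup = solve-∀ ℚ-ring

      step : ∀ α β → v β ℕ.^ m ℕ.* ∏ (λ i → mix (suc t) i ℕ.^ c i)
                       ℕ.≤ (v β ℕ.∸ t ℕ.* u α β) ℕ.^ m ℕ.* ∏ (λ i → mix t i ℕ.^ c i)
      step α β = fromℕ-cancel-≤ (subst₂ _≤_ (sym (fromℕ-power-product (v β) (mix (suc t))))
                                             (sym (fromℕ-power-product (v β ℕ.∸ t ℕ.* u α β) (mix t))) (step-ℚ α β))
        where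
        fromℕ-power-product : ∀ w (f : Fin q → ℕ) →
          fromℕ (w ℕ.^ m ℕ.* ∏ (λ i → f i ℕ.^ c i)) ≡ fromℕ w ^ m * ∏ℚ (λ i → fromℕ (f i) ^ c i)
        fromℕ-power-product w f = trans (fromℕ-* (w ℕ.^ m) _) (cong₂ _*_ (fromℕ-^ w m)
          (trans (sym (fromℕ-∏ (λ i → f i ℕ.^ c i))) (∏ℚ-cong {q} (λ i → fromℕ-^ (f i) (c i)))))

module Pinsker where
  open import Data.Nat
  open import Data.Nat.Properties
  open import Data.Nat.Tactic.RingSolver using (solve-∀)
  open import Data.Fin using (Fin; toℕ)
  open import Relation.Binary.PropositionalEquality
  open NatLemmas

  module CountPair {q} (c C : Fin q → ℕ) {m M : ℕ} (∑c≡m : ∑ c ≡ m) (∑C≡M : ∑ C ≡ M) (M>0 : 0 < M) where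
    open Interpolation.Path c C ∑c≡m ∑C≡M M>0 public using (T; A; mix; v; u)
    open Interpolation.Path c C ∑c≡m ∑C≡M M>0 using (module Step)

    -- With p = c / m and P = C / M, Y / X = ∏ (p i / P i) ^ c i = 2 ^ (m D(p ‖ P)) and A = T ‖p - P‖₁,
    -- so pinsker below says 2αβ ‖p - P‖₁ - α² ≤ 2β² D(p ‖ P).
    X Y : ℕ
    X = ∏ (λ i → (C i * m) ^ c i)
    Y = ∏ (λ i → (c i * M) ^ c i)

    P : ℕ → ℕ
    P t = ∏ (λ i → mix t i ^ c i)

    K : ℕ → ℕ
    K β = 2 * (β * β) * M

    ∏-scale : ∀ k (f : Fin q → ℕ) → ∏ (λ i → (k * f i) ^ c i) ≡ k ^ m * ∏ (λ i → f i ^ c i)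
    ∏-scale k f = begin
      ∏ (λ i → (k * f i) ^ c i)                ≡⟨ ∏-cong (λ i → ^-distribʳ-* k (f i) (c i)) ⟩
      ∏ (λ i → k ^ c i * f i ^ c i)            ≡⟨ ∏-distrib-* (λ i → k ^ c i) (λ i → f i ^ c i) ⟩
      ∏ (λ i → k ^ c i) * ∏ (λ i → f i ^ c i)  ≡⟨ cong (_* ∏ (λ i → f i ^ c i)) (trans (cong (k ^_) (sym ∑c≡m)) (^-∑ k c)) ⟨
      k ^ m * ∏ (λ i → f i ^ c i)              ∎
      where open ≡-Reasoning

    P5≡ : P 5 ≡ 5 ^ m * X
    P5≡ = trans (∏-cong (λ i → cong (_^ c i) (+-identityʳ (5 * (C i * m))))) (∏-scale 5 (λ i → C i * m))

    P0≡ : P 0 ≡ 5 ^ m * Y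
    P0≡ = ∏-scale 5 (λ i → c i * M)

    module _ (α β : ℕ) (m>0 : 0 < m) (β>0 : 0 < β) where
      open ≤-Reasoning

      E : ℕ
      E = v β * 4

      v>0 : 0 < v β
      v>0 = *-mono-≤ (*-mono-≤ {1} {25} (s≤s z≤n) (*-mono-≤ β>0 β>0)) (*-mono-≤ m>0 M>0)

      decayed-step : ∀ t → t < 5 → 32 ^ (t * u α β * m) * P (suc t) ^ E ≤ P t ^ E
      decayed-step t t<5 = *-cancelˡ-≤-pos (w ^ E) (^-positive E (^-positive m v>0)) (begin
        w ^ E * (32 ^ (s * m) * P (suc t) ^ E)    ≡⟨ x*[y*z]≡y*[x*z] (w ^ E) (32 ^ (s * m)) _ ⟩
        32 ^ (s * m) * (w ^ E * P (suc t) ^ E)    ≡⟨ cong (32 ^ (s * m) *_) (^-distribʳ-* w (P (suc t)) E) ⟨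
        32 ^ (s * m) * (w * P (suc t)) ^ E        ≤⟨ *-monoʳ-≤ (32 ^ (s * m)) (^-monoˡ-≤ E (Step.step t (≤-pred t<5) α β)) ⟩
        32 ^ (s * m) * ((v β ∸ s) ^ m * P t) ^ E  ≡⟨ regroup ⟩
        (32 ^ s * (v β ∸ s) ^ E) ^ m * P t ^ E    ≤⟨ *-monoˡ-≤ (P t ^ E) (^-monoˡ-≤ m (Decay.decay s (v β) v>0)) ⟩
        (v β ^ E) ^ m * P t ^ E                   ≡⟨ cong (_* P t ^ E) (^-swap (v β) E m) ⟩
        w ^ E * P t ^ E                           ∎)
        where
        w s : ℕ
        w = v β ^ m
        s = t * u α β
        regroup : 32 ^ (s * m) * ((v β ∸ s) ^ m * P t) ^ E ≡ (32 ^ s * (v β ∸ s) ^ E) ^ m * P t ^ E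
        regroup = begin-equality
          32 ^ (s * m) * ((v β ∸ s) ^ m * P t) ^ E
            ≡⟨ cong₂ _*_ (^-*-assoc 32 s m) (sym (^-distribʳ-* ((v β ∸ s) ^ m) (P t) E)) ⟨
          (32 ^ s) ^ m * (((v β ∸ s) ^ m) ^ E * P t ^ E)
            ≡⟨ cong (λ y → (32 ^ s) ^ m * (y * P t ^ E)) (^-swap (v β ∸ s) m E) ⟩
          (32 ^ s) ^ m * (((v β ∸ s) ^ E) ^ m * P t ^ E)
            ≡⟨ *-assoc ((32 ^ s) ^ m) _ _ ⟨
          (32 ^ s) ^ m * ((v β ∸ s) ^ E) ^ m * P t ^ E
            ≡⟨ cong (_* P t ^ E) (^-distribʳ-* (32 ^ s) ((v β ∸ s) ^ E) m) ⟨
          (32 ^ s * (v β ∸ s) ^ E) ^ m * P t ^ E ∎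

      total-decay : ∏ {5} (λ i → 32 ^ (toℕ i * u α β * m)) ≡ 2 ^ (u α β * (50 * m))
      total-decay = begin-equality
        ∏ {5} (λ i → 32 ^ (toℕ i * u α β * m))     ≡⟨ ^-∑ {5} 32 (λ i → toℕ i * u α β * m) ⟨
        32 ^ ∑ {5} (λ i → toℕ i * u α β * m)       ≡⟨ ^-*-assoc 2 5 (∑ {5} (λ i → toℕ i * u α β * m)) ⟩
        2 ^ (5 * ∑ {5} (λ i → toℕ i * u α β * m))  ≡⟨ cong (2 ^_) (sum-of-steps (u α β) m) ⟩
        2 ^ (u α β * (50 * m))                     ∎
        where
        sum-of-steps : ∀ u m → 5 * (0 * u * m + (1 * u * m + (2 * u * m + (3 * u * m + (4 * u * m + 0)))))
                                ≡ u * (50 * m)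
        sum-of-steps = solve-∀

      -- The five steps gain 2 ^ (5 (0 + 1 + 2 + 3 + 4) u m) = 2 ^ (50 u m), exactly matching E = 4v = 50 m K.
      pinsker-gain : 2 ^ u α β * X ^ K β ≤ Y ^ K β
      pinsker-gain = ^-cancelʳ-≤ (50 * m) (*-mono-≤ {1} {50} (s≤s z≤n) m>0) (begin
        (2 ^ u α β * X ^ K β) ^ (50 * m)               ≡⟨ ^-distribʳ-* (2 ^ u α β) (X ^ K β) (50 * m) ⟩
        (2 ^ u α β) ^ (50 * m) * (X ^ K β) ^ (50 * m)  ≡⟨ cong₂ _*_ (^-*-assoc 2 (u α β) (50 * m)) (^-*-assoc X (K β) (50 * m)) ⟩
        2 ^ (u α β * (50 * m)) * X ^ (K β * (50 * m))  ≡⟨ cong (λ e → 2 ^ (u α β * (50 * m)) * X ^ e) E≡ ⟨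
        2 ^ (u α β * (50 * m)) * X ^ E                 ≤⟨ *-cancelˡ-≤-pos ((5 ^ m) ^ E) (^-positive E (^-positive m (s≤s z≤n))) telescoped ⟩
        Y ^ E                                          ≡⟨ trans (cong (Y ^_) E≡) (sym (^-*-assoc Y (K β) (50 * m))) ⟩
        (Y ^ K β) ^ (50 * m)                           ∎)
        where
        E≡ : E ≡ K β * (50 * m)
        E≡ = exponent β m M
          where
          exponent : ∀ β m M → 25 * (β * β) * (m * M) * 4 ≡ 2 * (β * β) * M * (50 * m)
          exponent = solve-∀
        telescoped : (5 ^ m) ^ E * (2 ^ (u α β * (50 * m)) * X ^ E) ≤ (5 ^ m) ^ E * Y ^ E
        telescoped = begin
          (5 ^ m) ^ E * (2 ^ (u α β * (50 * m)) * X ^ E)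
            ≡⟨ x*[y*z]≡y*[x*z] ((5 ^ m) ^ E) (2 ^ (u α β * (50 * m))) (X ^ E) ⟩
          2 ^ (u α β * (50 * m)) * ((5 ^ m) ^ E * X ^ E)
            ≡⟨ cong₂ _*_ total-decay (trans (cong (_^ E) P5≡) (^-distribʳ-* (5 ^ m) X E)) ⟨
          ∏ {5} (λ i → 32 ^ (toℕ i * u α β * m)) * P 5 ^ E
            ≤⟨ telescope-≤ 5 (λ t → 32 ^ (t * u α β * m)) (λ t → P t ^ E) decayed-step ⟩
          P 0 ^ E
            ≡⟨ trans (cong (_^ E) P0≡) (^-distribʳ-* (5 ^ m) Y E) ⟩
          (5 ^ m) ^ E * Y ^ E ∎

      pinsker : 2 ^ (2 * α * β * A) * X ^ K β ≤ Y ^ K β * 2 ^ (α * α * T)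
      pinsker = begin
        2 ^ (2 * α * β * A) * X ^ K β          ≤⟨ *-monoˡ-≤ (X ^ K β) (^-monoʳ-≤ 2 (m≤n+m∸n (2 * α * β * A) (α * α * T))) ⟩
        2 ^ (α * α * T + u α β) * X ^ K β      ≡⟨ cong (_* X ^ K β) (^-distribˡ-+-* 2 (α * α * T) (u α β)) ⟩
        2 ^ (α * α * T) * 2 ^ u α β * X ^ K β  ≡⟨ rotate (2 ^ (α * α * T)) (2 ^ u α β) (X ^ K β) ⟩
        2 ^ u α β * X ^ K β * 2 ^ (α * α * T)  ≤⟨ *-monoˡ-≤ (2 ^ (α * α * T)) pinsker-gain ⟩
        Y ^ K β * 2 ^ (α * α * T)              ∎
        where
        rotate : ∀ a b x → a * b * x ≡ b * x * a
        rotate = solve-∀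

    gibbs : 0 < m → X ≤ Y
    gibbs m>0 = ^-cancelʳ-≤ (K 1) (*-mono-≤ {1} {2} (s≤s z≤n) M>0)
      (subst (_≤ Y ^ K 1) (+-identityʳ (X ^ K 1)) (pinsker-gain 0 1 m>0 (s≤s z≤n)))

module LabelledTrees where
  open import Data.Nat hiding (_≟_)
  open import Data.Nat.Properties hiding (_≟_)
  open import Data.Nat.Tactic.RingSolver using (solve-∀)
  open import Data.Fin using (Fin; zero; suc; _≟_)
  open import Data.List using (map; foldr; tabulate; allFin)
  import Data.Vec.Functional as Vector
  open import Function using (id; _∘_)
  open import Relation.Binary.PropositionalEquality
  open import Relation.Nullary using (yes; no)
  open import Data.Empty using (⊥-elim)
  open import Defs
  open NatLemmas

  foldr-map-allFin : ∀ {A : Set} (_∙_ : A → A → A) (ε : A) {n} (f : Fin n → A) →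
                     foldr _∙_ ε (map f (allFin n)) ≡ Vector.foldr _∙_ ε f
  foldr-map-allFin _∙_ ε f = go id
    where
    go : ∀ {n} (g : Fin n → Fin _) → foldr _∙_ ε (map f (tabulate g)) ≡ Vector.foldr _∙_ ε (f ∘ g)
    go {zero} g = refl
    go {suc n} g = cong (f (g zero) ∙_) (go (g ∘ suc))

  count-node : ∀ {k q h} (i : Fin q) (ch : Fin k → Tree k q h) → count i (node ch) ≡ ∑ (λ j → count i (ch j))
  count-node i ch = foldr-map-allFin _+_ 0 (λ j → count i (ch j))

  count-leaf-≡ : ∀ {k q} (i : Fin q) → count {k} i (leaf i) ≡ 1
  count-leaf-≡ i with i ≟ i
  ... | yes _ = refl
  ... | no i≢i = ⊥-elim (i≢i refl)

  count-leaf-≢ : ∀ {k q} {i j : Fin q} → i ≢ j → count {k} i (leaf j) ≡ 0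
  count-leaf-≢ {i = i} {j} i≢j with i ≟ j
  ... | yes i≡j = ⊥-elim (i≢j i≡j)
  ... | no _ = refl

  ∑-count : ∀ {k q} h (T : Tree k q h) → ∑ (λ i → count i T) ≡ k ^ h
  ∑-count {k} zero (leaf j) = ∑-indicator j (count-leaf-≡ {k} j) (λ i → count-leaf-≢ {k})
  ∑-count {k} (suc h) (node ch) = begin
    ∑ (λ i → count i (node ch))         ≡⟨ ∑-cong (λ i → count-node i ch) ⟩
    ∑ (λ i → ∑ (λ j → count i (ch j)))  ≡⟨ ∑-comm (λ i j → count i (ch j)) ⟩
    ∑ (λ j → ∑ (λ i → count i (ch j)))  ≡⟨ ∑-cong (λ j → ∑-count h (ch j)) ⟩
    ∑ {k} (λ _ → k ^ h)                 ≡⟨ ∑-const k (k ^ h) ⟩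
    k ^ suc h                           ∎
    where open ≡-Reasoning

  -- N ^ N / powerProduct T = 2 ^ (N · H), where H is the entropy of the label distribution of T and N = k ^ h.
  powerProduct : ∀ {k q h} → Tree k q h → ℕ
  powerProduct T = ∏ (λ i → count i T ^ count i T)

  powerProduct>0 : ∀ {k q h} (T : Tree k q h) → 0 < powerProduct T
  powerProduct>0 T = ∏-positive (λ i → n^n>0 (count i T))

  powerProduct-leaf : ∀ {k q} (j : Fin q) → powerProduct {k} (leaf j) ≡ 1
  powerProduct-leaf {k} {q} j = trans (∏-cong factor) (trans (∏-const q 1) (^-zeroˡ q))
    where
    factor : ∀ i → count {k} i (leaf j) ^ count {k} i (leaf j) ≡ 1
    factor i with i ≟ j
    ... | yes _ = refl
    ... | no _ = refl

  -- Σ_i ∣μ_i(T_y) - μ_i(T_x)∣ for the j-th child y of x = node ch, scaled by the number k ^ (h + 1)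
  -- of leaves of T_x.
  nodeDeviation : ∀ {k q h} → (Fin k → Tree k q h) → Fin k → ℕ
  nodeDeviation {k} ch j = ∑ (λ i → ∣ k * count i (ch j) - count i (node ch) ∣)

  deviation : ∀ {k q h} → Tree k q h → ℕ
  deviation (leaf _) = 0
  deviation (node ch) = ∑ (nodeDeviation ch) + ∑ (λ j → deviation (ch j))

  child-pinsker : ∀ {k q h} α β → 0 < k → 0 < β → (ch : Fin k → Tree k q h) (j : Fin k) →
    2 ^ (2 * α * β * nodeDeviation ch j) * ∏ (λ i → (count i (node ch) * k ^ h) ^ count i (ch j)) ^ (2 * (β * β) * k)
      ≤ ∏ (λ i → (count i (ch j) * k ^ suc h) ^ count i (ch j)) ^ (2 * (β * β) * k) * 2 ^ (α * α * k ^ suc h)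
  child-pinsker {k} {q} {h} α β k>0 β>0 ch j =
    ^-cancelʳ-≤ m m>0 (subst₂ _≤_ lhs rhs (Pair.pinsker α β m>0 β>0))
    where
    m M : ℕ
    m = k ^ h
    M = k ^ suc h
    c C : Fin q → ℕ
    c i = count i (ch j)
    C i = count i (node ch)
    m>0 : 0 < m
    m>0 = ^-positive h k>0
    K′ : ℕ
    K′ = 2 * (β * β) * k
    module Pair = Pinsker.CountPair c C (∑-count h (ch j)) (∑-count (suc h) (node ch)) (^-positive (suc h) k>0)
    A≡ : Pair.A ≡ nodeDeviation ch j * m
    A≡ = begin
      ∑ (λ i → ∣ c i * M - C i * m ∣)  ≡⟨ ∑-cong term≡ ⟩
      ∑ (λ i → ∣ k * c i - C i ∣ * m)  ≡⟨ ∑-cong (λ i → *-comm (∣ k * c i - C i ∣) m) ⟩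
      ∑ (λ i → m * ∣ k * c i - C i ∣)  ≡⟨ *-distribˡ-∑ m (λ i → ∣ k * c i - C i ∣) ⟨
      m * nodeDeviation ch j           ≡⟨ *-comm m _ ⟩
      nodeDeviation ch j * m           ∎
      where
      open ≡-Reasoning
      term≡ : ∀ i → ∣ c i * M - C i * m ∣ ≡ ∣ k * c i - C i ∣ * m
      term≡ i = trans (cong (λ x → ∣ x - C i * m ∣) (trans (sym (*-assoc (c i) k m)) (cong (_* m) (*-comm (c i) k))))
                      (sym (*-distribʳ-∣-∣ m (k * c i) (C i)))
    K≡ : Pair.K β ≡ K′ * m
    K≡ = regroup β k m
      where
      regroup : ∀ β k m → 2 * (β * β) * (k * m) ≡ 2 * (β * β) * k * m
      regroup = solve-∀
    lhs : 2 ^ (2 * α * β * Pair.A) * Pair.X ^ Pair.K β ≡ (2 ^ (2 * α * β * nodeDeviation ch j) * Pair.X ^ K′) ^ m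
    lhs = begin
      2 ^ (2 * α * β * Pair.A) * Pair.X ^ Pair.K β
        ≡⟨ cong₂ (λ a b → 2 ^ (2 * α * β * a) * Pair.X ^ b) A≡ K≡ ⟩
      2 ^ (2 * α * β * (nodeDeviation ch j * m)) * Pair.X ^ (K′ * m)
        ≡⟨ cong₂ _*_ (trans (cong (2 ^_) (sym (*-assoc (2 * α * β) (nodeDeviation ch j) m))) (sym (^-*-assoc 2 (2 * α * β * nodeDeviation ch j) m))) (sym (^-*-assoc Pair.X K′ m)) ⟩
      (2 ^ (2 * α * β * nodeDeviation ch j)) ^ m * (Pair.X ^ K′) ^ m
        ≡⟨ ^-distribʳ-* (2 ^ (2 * α * β * nodeDeviation ch j)) (Pair.X ^ K′) m ⟨
      (2 ^ (2 * α * β * nodeDeviation ch j) * Pair.X ^ K′) ^ m ∎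
      where open ≡-Reasoning
    rhs : Pair.Y ^ Pair.K β * 2 ^ (α * α * Pair.T) ≡ (Pair.Y ^ K′ * 2 ^ (α * α * M)) ^ m
    rhs = begin
      Pair.Y ^ Pair.K β * 2 ^ (α * α * (m * M))
        ≡⟨ cong₂ (λ a b → Pair.Y ^ a * 2 ^ b) K≡ (regroup α m M) ⟩
      Pair.Y ^ (K′ * m) * 2 ^ (α * α * M * m)
        ≡⟨ cong₂ _*_ (sym (^-*-assoc Pair.Y K′ m)) (sym (^-*-assoc 2 (α * α * M) m)) ⟩
      (Pair.Y ^ K′) ^ m * (2 ^ (α * α * M)) ^ m
        ≡⟨ ^-distribʳ-* (Pair.Y ^ K′) (2 ^ (α * α * M)) m ⟨
      (Pair.Y ^ K′ * 2 ^ (α * α * M)) ^ m ∎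
      where
      open ≡-Reasoning
      regroup : ∀ α m M → α * α * (m * M) ≡ α * α * M * m
      regroup = solve-∀

  module ChainRule {k q : ℕ} (α β : ℕ) (k>0 : 0 < k) (β>0 : 0 < β) where
    K : ℕ
    K = 2 * (β * β) * k

    module Node {h} (ch : Fin k → Tree k q h) where
      m M : ℕ
      m = k ^ h
      M = k ^ suc h

      X Y G : Fin k → ℕ
      X j = ∏ (λ i → (count i (node ch) * m) ^ count i (ch j))
      Y j = ∏ (λ i → (count i (ch j) * M) ^ count i (ch j))
      G j = powerProduct (ch j)

      ∏X≡ : ∏ X ≡ powerProduct (node ch) * m ^ M
      ∏X≡ = begin
        ∏ (λ j → ∏ (λ i → (C i * m) ^ count i (ch j)))
          ≡⟨ ∏-comm (λ j i → (C i * m) ^ count i (ch j)) ⟩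
        ∏ (λ i → ∏ (λ j → (C i * m) ^ count i (ch j)))
          ≡⟨ ∏-cong (λ i → trans (sym (^-∑ (C i * m) (λ j → count i (ch j)))) (cong ((C i * m) ^_) (sym (count-node i ch)))) ⟩
        ∏ (λ i → (C i * m) ^ C i)
          ≡⟨ ∏-cong (λ i → ^-distribʳ-* (C i) m (C i)) ⟩
        ∏ (λ i → C i ^ C i * m ^ C i)
          ≡⟨ ∏-distrib-* (λ i → C i ^ C i) (λ i → m ^ C i) ⟩
        powerProduct (node ch) * ∏ (λ i → m ^ C i)
          ≡⟨ cong (powerProduct (node ch) *_) (trans (sym (^-∑ m C)) (cong (m ^_) (∑-count (suc h) (node ch)))) ⟩
        powerProduct (node ch) * m ^ M ∎
        where
        open ≡-Reasoning
        C : Fin q → ℕ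
        C i = count i (node ch)

      ∏Y≡ : ∏ Y ≡ ∏ G * M ^ M
      ∏Y≡ = begin
        ∏ (λ j → ∏ (λ i → (c j i * M) ^ c j i))  ≡⟨ ∏-cong child ⟩
        ∏ (λ j → G j * M ^ m)                    ≡⟨ ∏-distrib-* G (λ _ → M ^ m) ⟩
        ∏ G * ∏ {k} (λ _ → M ^ m)                ≡⟨ cong (∏ G *_) (trans (∏-const k (M ^ m)) (trans (^-*-assoc M m k) (cong (M ^_) (*-comm m k)))) ⟩
        ∏ G * M ^ M                              ∎
        where
        open ≡-Reasoning
        c : Fin k → Fin q → ℕ
        c j i = count i (ch j)
        child : ∀ j → ∏ (λ i → (c j i * M) ^ c j i) ≡ G j * M ^ m
        child j = begin
          ∏ (λ i → (c j i * M) ^ c j i)        ≡⟨ ∏-cong (λ i → ^-distribʳ-* (c j i) M (c j i)) ⟩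
          ∏ (λ i → c j i ^ c j i * M ^ c j i)  ≡⟨ ∏-distrib-* (λ i → c j i ^ c j i) (λ i → M ^ c j i) ⟩
          G j * ∏ (λ i → M ^ c j i)            ≡⟨ cong (G j *_) (trans (sym (^-∑ M (c j))) (cong (M ^_) (∑-count h (ch j)))) ⟩
          G j * M ^ m                          ∎

      a b : Fin k → ℕ
      a j = 2 * α * β * nodeDeviation ch j
      b j = 2 * α * β * deviation (ch j)

      Z : ℕ
      Z = m ^ M * ∏ G

      Z>0 : 0 < Z
      Z>0 = *-mono-≤ (^-positive M (^-positive h k>0)) (∏-positive (λ j → powerProduct>0 (ch j)))

      E₁ : ℕ
      E₁ = α * α * M + α * α * h * M

      ∑a+b≡ : ∑ (λ j → a j + b j) ≡ 2 * α * β * deviation (node ch)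
      ∑a+b≡ = begin
        ∑ (λ j → a j + b j)
          ≡⟨ ∑-distrib-+ a b ⟩
        ∑ a + ∑ b
          ≡⟨ cong₂ _+_ (*-distribˡ-∑ (2 * α * β) (nodeDeviation ch)) (*-distribˡ-∑ (2 * α * β) (deviation ∘ ch)) ⟨
        2 * α * β * ∑ (nodeDeviation ch) + 2 * α * β * ∑ (deviation ∘ ch)
          ≡⟨ *-distribˡ-+ (2 * α * β) _ _ ⟨
        2 * α * β * deviation (node ch) ∎
        where open ≡-Reasoning

      ∏-lhs : ∏ (λ j → 2 ^ (a j + b j) * (X j * G j) ^ K) ≡ Z ^ K * (2 ^ (2 * α * β * deviation (node ch)) * powerProduct (node ch) ^ K)
      ∏-lhs = begin
        ∏ (λ j → 2 ^ (a j + b j) * (X j * G j) ^ K)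
          ≡⟨ ∏-distrib-* (λ j → 2 ^ (a j + b j)) (λ j → (X j * G j) ^ K) ⟩
        ∏ (λ j → 2 ^ (a j + b j)) * ∏ (λ j → (X j * G j) ^ K)
          ≡⟨ cong₂ _*_ (trans (sym (^-∑ 2 (λ j → a j + b j))) (cong (2 ^_) ∑a+b≡)) (trans (∏-^ (λ j → X j * G j) K) (cong (_^ K) (∏-distrib-* X G))) ⟩
        2 ^ (2 * α * β * deviation (node ch)) * (∏ X * ∏ G) ^ K
          ≡⟨ cong (λ x → 2 ^ (2 * α * β * deviation (node ch)) * (x * ∏ G) ^ K) ∏X≡ ⟩
        2 ^ (2 * α * β * deviation (node ch)) * (powerProduct (node ch) * m ^ M * ∏ G) ^ K
          ≡⟨ cong (λ x → 2 ^ (2 * α * β * deviation (node ch)) * x ^ K) (*-assoc (powerProduct (node ch)) (m ^ M) (∏ G)) ⟩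
        2 ^ (2 * α * β * deviation (node ch)) * (powerProduct (node ch) * Z) ^ K
          ≡⟨ cong (2 ^ (2 * α * β * deviation (node ch)) *_) (^-distribʳ-* (powerProduct (node ch)) Z K) ⟩
        2 ^ (2 * α * β * deviation (node ch)) * (powerProduct (node ch) ^ K * Z ^ K)
          ≡⟨ rotate (2 ^ (2 * α * β * deviation (node ch))) (powerProduct (node ch) ^ K) (Z ^ K) ⟩
        Z ^ K * (2 ^ (2 * α * β * deviation (node ch)) * powerProduct (node ch) ^ K) ∎
        where
        open ≡-Reasoning
        rotate : ∀ x y z → x * (y * z) ≡ z * (x * y)
        rotate = solve-∀

      ∏-rhs : ∏ (λ j → (Y j * m ^ m) ^ K * 2 ^ E₁) ≡ Z ^ K * ((M ^ M) ^ K * 2 ^ (α * α * suc h * k ^ suc (suc h)))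
      ∏-rhs = begin
        ∏ (λ j → (Y j * m ^ m) ^ K * 2 ^ E₁)
          ≡⟨ ∏-distrib-* (λ j → (Y j * m ^ m) ^ K) (λ _ → 2 ^ E₁) ⟩
        ∏ (λ j → (Y j * m ^ m) ^ K) * ∏ {k} (λ _ → 2 ^ E₁)
          ≡⟨ cong₂ _*_ (trans (∏-^ (λ j → Y j * m ^ m) K) (cong (_^ K) (∏-distrib-* Y (λ _ → m ^ m))))
                       (trans (∏-const k (2 ^ E₁)) (^-*-assoc 2 E₁ k)) ⟩
        (∏ Y * ∏ {k} (λ _ → m ^ m)) ^ K * 2 ^ (E₁ * k)
          ≡⟨ cong₂ (λ x y → (x * y) ^ K * 2 ^ (E₁ * k)) ∏Y≡ (trans (∏-const k (m ^ m)) (trans (^-*-assoc m m k) (cong (m ^_) (*-comm m k)))) ⟩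
        (∏ G * M ^ M * m ^ M) ^ K * 2 ^ (E₁ * k)
          ≡⟨ cong₂ (λ x y → x ^ K * 2 ^ y) (regroup (∏ G) (M ^ M) (m ^ M)) (exponent α h k M) ⟩
        (M ^ M * Z) ^ K * 2 ^ (α * α * suc h * k ^ suc (suc h))
          ≡⟨ cong (_* 2 ^ (α * α * suc h * k ^ suc (suc h))) (^-distribʳ-* (M ^ M) Z K) ⟩
        (M ^ M) ^ K * Z ^ K * 2 ^ (α * α * suc h * k ^ suc (suc h))
          ≡⟨ swap-front ((M ^ M) ^ K) (Z ^ K) (2 ^ (α * α * suc h * k ^ suc (suc h))) ⟩
        Z ^ K * ((M ^ M) ^ K * 2 ^ (α * α * suc h * k ^ suc (suc h))) ∎
        where
        open ≡-Reasoning
        regroup : ∀ g a b → g * a * b ≡ a * (b * g)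
        regroup = solve-∀
        exponent : ∀ α h k M → (α * α * M + α * α * h * M) * k ≡ α * α * (1 + h) * (k * M)
        exponent = solve-∀
        swap-front : ∀ x z y → x * z * y ≡ z * (x * y)
        swap-front = solve-∀

    chain-rule : ∀ h (T : Tree k q h) →
                 2 ^ (2 * α * β * deviation T) * powerProduct T ^ K ≤ ((k ^ h) ^ (k ^ h)) ^ K * 2 ^ (α * α * h * k ^ suc h)
    chain-rule zero (leaf j) = begin
      2 ^ (2 * α * β * 0) * powerProduct {k} (leaf j) ^ K  ≡⟨ cong₂ (λ a b → 2 ^ a * b ^ K) (*-zeroʳ (2 * α * β)) (powerProduct-leaf {k} j) ⟩
      1 * 1 ^ K                                            ≡⟨ cong (1 *_) (^-zeroˡ K) ⟩
      1                                                    ≤⟨ *-mono-≤ (^-positive K (s≤s z≤n)) (^-positive (α * α * 0 * k ^ 1) (s≤s z≤n)) ⟩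
      1 ^ K * 2 ^ (α * α * 0 * k ^ 1)                      ∎
      where open ≤-Reasoning
    chain-rule (suc h) (node ch) = *-cancelˡ-≤-pos (Z ^ K) (^-positive K Z>0) (subst₂ _≤_ ∏-lhs ∏-rhs (∏-mono-≤ per-child))
      where
      open Node ch
      per-child : ∀ j → 2 ^ (a j + b j) * (X j * G j) ^ K ≤ (Y j * m ^ m) ^ K * 2 ^ E₁
      per-child j = subst₂ _≤_ merge-left merge-right (*-mono-≤ (child-pinsker α β k>0 β>0 ch j) (chain-rule h (ch j)))
        where
        merge-left : 2 ^ a j * X j ^ K * (2 ^ b j * G j ^ K) ≡ 2 ^ (a j + b j) * (X j * G j) ^ K
        merge-left = trans (*-interchange (2 ^ a j) (X j ^ K) (2 ^ b j) (G j ^ K))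
                           (sym (cong₂ _*_ (^-distribˡ-+-* 2 (a j) (b j)) (^-distribʳ-* (X j) (G j) K)))
        merge-right : Y j ^ K * 2 ^ (α * α * M) * ((m ^ m) ^ K * 2 ^ (α * α * h * M)) ≡ (Y j * m ^ m) ^ K * 2 ^ E₁
        merge-right = trans (*-interchange (Y j ^ K) (2 ^ (α * α * M)) ((m ^ m) ^ K) (2 ^ (α * α * h * M)))
                            (sym (cong₂ _*_ (^-distribʳ-* (Y j) (m ^ m) K) (^-distribˡ-+-* 2 (α * α * M) (α * α * h * M))))

  open ChainRule public using (chain-rule)

  labels>0 : ∀ {k q h} → 0 < k → Tree k q h → 0 < q
  labels>0 {q = suc q} _ (leaf _) = s≤s z≤n
  labels>0 {k = suc k} k>0 (node ch) = labels>0 k>0 (ch zero)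

  entropy-bound : ∀ {k q h} → 0 < k → (T : Tree k q h) → (k ^ h) ^ (k ^ h) ≤ powerProduct T * q ^ (k ^ h)
  entropy-bound {k} {q} {h} k>0 T = subst₂ _≤_ X≡ Y≡ (Uniform.gibbs (^-positive h k>0))
    where
    N : ℕ
    N = k ^ h
    c : Fin q → ℕ
    c i = count i T
    module Uniform = Pinsker.CountPair c (λ _ → 1) (∑-count h T) (trans (∑-const q 1) (*-identityʳ q)) (labels>0 k>0 T)
    X≡ : Uniform.X ≡ N ^ N
    X≡ = trans (∏-cong (λ i → cong (_^ c i) (+-identityʳ N))) (trans (sym (^-∑ N c)) (cong (N ^_) (∑-count h T)))
    Y≡ : Uniform.Y ≡ powerProduct T * q ^ N
    Y≡ = begin
      ∏ (λ i → (c i * q) ^ c i)           ≡⟨ ∏-cong (λ i → ^-distribʳ-* (c i) q (c i)) ⟩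
      ∏ (λ i → c i ^ c i * q ^ c i)       ≡⟨ ∏-distrib-* (λ i → c i ^ c i) (λ i → q ^ c i) ⟩
      powerProduct T * ∏ (λ i → q ^ c i)  ≡⟨ cong (powerProduct T *_) (trans (sym (^-∑ q c)) (cong (q ^_) (∑-count h T))) ⟩
      powerProduct T * q ^ N              ∎
      where open ≡-Reasoning

module PathAverages where
  open import Tactic.RingSolver using (solve-∀)
  open import Data.Nat as ℕ using (ℕ; zero; suc)
  import Data.Nat.Properties as ℕ
  open import Data.Fin using (Fin)
  open import Data.List using (List; []; _∷_; map; _++_; concatMap; take; upTo; applyUpTo; length; allFin)
  import Data.List.Properties as List
  open import Data.Rational using (ℚ; _+_; _*_; _-_; ∣_∣; 0ℚ; 1ℚ)
  open import Data.Rational.Properties using (+-identityˡ; +-assoc; *-assoc; *-comm; *-zeroˡ; *-identityˡ; 0≤p⇒∣p∣≡p; ∣p*q∣≡∣p∣*∣q∣)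
  open import Function using (id; _∘_)
  open import Relation.Binary.PropositionalEquality
  open import Defs
  open RationalLemmas
  open NatLemmas using (∑; ^-positive)
  open LabelledTrees using (foldr-map-allFin; nodeDeviation; deviation)

  sumℚ-allFin : ∀ {n} (f : Fin n → ℚ) → sumℚ (map f (allFin n)) ≡ ∑ℚ f
  sumℚ-allFin = foldr-map-allFin _+_ 0ℚ

  sumℚ-++ : ∀ (xs ys : List ℚ) → sumℚ (xs ++ ys) ≡ sumℚ xs + sumℚ ys
  sumℚ-++ [] ys = sym (+-identityˡ (sumℚ ys))
  sumℚ-++ (x ∷ xs) ys = trans (cong (x +_) (sumℚ-++ xs ys)) (sym (+-assoc x (sumℚ xs) (sumℚ ys)))

  module _ {A : Set} where
    sumℚ-cong : ∀ {f g : A → ℚ} → (∀ x → f x ≡ g x) → ∀ xs → sumℚ (map f xs) ≡ sumℚ (map g xs)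
    sumℚ-cong f≗g xs = cong sumℚ (List.map-cong f≗g xs)

    sumℚ-concatMap : ∀ {B : Set} (F : B → ℚ) (g : A → List B) xs →
                     sumℚ (map F (concatMap g xs)) ≡ sumℚ (map (λ x → sumℚ (map F (g x))) xs)
    sumℚ-concatMap F g [] = refl
    sumℚ-concatMap F g (x ∷ xs) = begin
      sumℚ (map F (g x ++ concatMap g xs))                           ≡⟨ cong sumℚ (List.map-++ F (g x) (concatMap g xs)) ⟩
      sumℚ (map F (g x) ++ map F (concatMap g xs))                   ≡⟨ sumℚ-++ (map F (g x)) (map F (concatMap g xs)) ⟩
      sumℚ (map F (g x)) + sumℚ (map F (concatMap g xs))             ≡⟨ cong (sumℚ (map F (g x)) +_) (sumℚ-concatMap F g xs) ⟩
      sumℚ (map F (g x)) + sumℚ (map (λ x → sumℚ (map F (g x))) xs)  ∎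
      where open ≡-Reasoning

    sumℚ-const+ : ∀ c (f : A → ℚ) xs → sumℚ (map (λ x → c + f x) xs) ≡ fromℕ (length xs) * c + sumℚ (map f xs)
    sumℚ-const+ c f [] = sym (trans (cong (_+ 0ℚ) (*-zeroˡ c)) (+-identityˡ 0ℚ))
    sumℚ-const+ c f (x ∷ xs) = begin
      c + f x + sumℚ (map (λ x → c + f x) xs)                 ≡⟨ cong (c + f x +_) (sumℚ-const+ c f xs) ⟩
      c + f x + (fromℕ (length xs) * c + sumℚ (map f xs))     ≡⟨ regroup c (f x) (fromℕ (length xs)) (sumℚ (map f xs)) ⟩
      (1ℚ + fromℕ (length xs)) * c + (f x + sumℚ (map f xs))  ≡⟨ cong (λ n → n * c + (f x + sumℚ (map f xs))) (fromℕ-suc (length xs)) ⟨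
      fromℕ (suc (length xs)) * c + (f x + sumℚ (map f xs))   ∎
      where
      open ≡-Reasoning
      regroup : ∀ c y n s → c + y + (n * c + s) ≡ (1ℚ + n) * c + (y + s)
      regroup = solve-∀ ℚ-ring

  map-applyUpTo : ∀ {A B : Set} (f : A → B) (g : ℕ → A) n → map f (applyUpTo g n) ≡ applyUpTo (f ∘ g) n
  map-applyUpTo f g zero = refl
  map-applyUpTo f g (suc n) = cong (f (g 0) ∷_) (map-applyUpTo f (g ∘ suc) n)

  length-paths : ∀ k h → length (paths k h) ≡ k ℕ.^ h
  length-paths k zero = refl
  length-paths k (suc h) = trans (length-prefixed (allFin k)) (cong (ℕ._* k ℕ.^ h) (List.length-tabulate {n = k} id))
    where
    length-prefixed : ∀ (js : List (Fin k)) → length (concatMap (λ j → map (j ∷_) (paths k h)) js) ≡ length js ℕ.* k ℕ.^ h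
    length-prefixed [] = refl
    length-prefixed (j ∷ js) = trans (List.length-++ (map (j ∷_) (paths k h)))
      (cong₂ ℕ._+_ (trans (List.length-map (j ∷_) (paths k h)) (length-paths k h)) (length-prefixed js))

  pathDivergence : ∀ {k q h} → Tree k q h → List (Fin k) → ℚ
  pathDivergence {h = h} T u = sumℚ (map (λ t → divAt (subtreeAt T (take t u))) (upTo h))

  totalDivergence : ∀ {k q h} → Tree k q h → ℚ
  totalDivergence {k} {h = h} T = sumℚ (map (pathDivergence T) (paths k h))

  pathDivergence-node : ∀ {k q h} (ch : Fin k → Tree k q h) j u →
                        pathDivergence (node ch) (j ∷ u) ≡ divergence (node ch) + pathDivergence (ch j) u
  pathDivergence-node {h = h} ch j u =
    cong (divergence (node ch) +_) (cong sumℚ (trans (map-applyUpTo along suc h) (sym (map-applyUpTo (along ∘ suc) id h))))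
    where
    along : ℕ → ℚ
    along t = divAt (subtreeAt (node ch) (take t (j ∷ u)))

  totalDivergence-node : ∀ {k q h} (ch : Fin k → Tree k q h) →
    totalDivergence (node ch) ≡ fromℕ (k ℕ.^ suc h) * divergence (node ch) + ∑ℚ (λ j → totalDivergence (ch j))
  totalDivergence-node {k} {q} {h} ch = begin
    totalDivergence (node ch)
      ≡⟨ sumℚ-concatMap (pathDivergence (node ch)) (λ j → map (j ∷_) (paths k h)) (allFin k) ⟩
    sumℚ (map (λ j → sumℚ (map (pathDivergence (node ch)) (map (j ∷_) (paths k h)))) (allFin k))
      ≡⟨ sumℚ-allFin (λ j → sumℚ (map (pathDivergence (node ch)) (map (j ∷_) (paths k h)))) ⟩
    ∑ℚ (λ j → sumℚ (map (pathDivergence (node ch)) (map (j ∷_) (paths k h))))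
      ≡⟨ ∑ℚ-cong {k} through-child ⟩
    ∑ℚ (λ j → fromℕ (k ℕ.^ h) * divergence (node ch) + totalDivergence (ch j))
      ≡⟨ ∑ℚ-distrib-+ (λ _ → fromℕ (k ℕ.^ h) * divergence (node ch)) (λ j → totalDivergence (ch j)) ⟩
    ∑ℚ {k} (λ _ → fromℕ (k ℕ.^ h) * divergence (node ch)) + ∑ℚ (λ j → totalDivergence (ch j))
      ≡⟨ cong (_+ ∑ℚ (λ j → totalDivergence (ch j))) leaves-below ⟩
    fromℕ (k ℕ.^ suc h) * divergence (node ch) + ∑ℚ (λ j → totalDivergence (ch j)) ∎
    where
    open ≡-Reasoning
    through-child : ∀ j → sumℚ (map (pathDivergence (node ch)) (map (j ∷_) (paths k h)))
                          ≡ fromℕ (k ℕ.^ h) * divergence (node ch) + totalDivergence (ch j)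
    through-child j = begin
      sumℚ (map (pathDivergence (node ch)) (map (j ∷_) (paths k h)))
        ≡⟨ cong sumℚ (List.map-∘ (paths k h)) ⟨
      sumℚ (map (pathDivergence (node ch) ∘ (j ∷_)) (paths k h))
        ≡⟨ sumℚ-cong (pathDivergence-node ch j) (paths k h) ⟩
      sumℚ (map (λ u → divergence (node ch) + pathDivergence (ch j) u) (paths k h))
        ≡⟨ sumℚ-const+ (divergence (node ch)) (pathDivergence (ch j)) (paths k h) ⟩
      fromℕ (length (paths k h)) * divergence (node ch) + totalDivergence (ch j)
        ≡⟨ cong (λ n → fromℕ n * divergence (node ch) + totalDivergence (ch j)) (length-paths k h) ⟩
      fromℕ (k ℕ.^ h) * divergence (node ch) + totalDivergence (ch j) ∎
    leaves-below : ∑ℚ {k} (λ _ → fromℕ (k ℕ.^ h) * divergence (node ch)) ≡ fromℕ (k ℕ.^ suc h) * divergence (node ch)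
    leaves-below = begin
      ∑ℚ {k} (λ _ → fromℕ (k ℕ.^ h) * divergence (node ch))  ≡⟨ ∑ℚ-const k (fromℕ (k ℕ.^ h) * divergence (node ch)) ⟩
      fromℕ k * (fromℕ (k ℕ.^ h) * divergence (node ch))     ≡⟨ *-assoc (fromℕ k) (fromℕ (k ℕ.^ h)) (divergence (node ch)) ⟨
      fromℕ k * fromℕ (k ℕ.^ h) * divergence (node ch)       ≡⟨ cong (_* divergence (node ch)) (fromℕ-* k (k ℕ.^ h)) ⟨
      fromℕ (k ℕ.^ suc h) * divergence (node ch)             ∎

  ∣frac-frac∣ : ∀ {k m} a b → 0 ℕ.< k → 0 ℕ.< m → ∣ frac a m - frac b (k ℕ.* m) ∣ * fromℕ (k ℕ.* m) ≡ fromℕ ℕ.∣ k ℕ.* a - b ∣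
  ∣frac-frac∣ {k} {m} a b k>0 m>0 = begin
    ∣ frac a m - frac b (k ℕ.* m) ∣ * fromℕ (k ℕ.* m)      ≡⟨ cong (∣ frac a m - frac b (k ℕ.* m) ∣ *_) (0≤p⇒∣p∣≡p (fromℕ-nonNeg (k ℕ.* m))) ⟨
    ∣ frac a m - frac b (k ℕ.* m) ∣ * ∣ fromℕ (k ℕ.* m) ∣  ≡⟨ ∣p*q∣≡∣p∣*∣q∣ (frac a m - frac b (k ℕ.* m)) (fromℕ (k ℕ.* m)) ⟨
    ∣ (frac a m - frac b (k ℕ.* m)) * fromℕ (k ℕ.* m) ∣    ≡⟨ cong ∣_∣ scaled ⟩
    ∣ fromℕ (k ℕ.* a) - fromℕ b ∣                          ≡⟨ ∣fromℕ-fromℕ∣ (k ℕ.* a) b ⟩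
    fromℕ ℕ.∣ k ℕ.* a - b ∣                                ∎
    where
    open ≡-Reasoning
    x y : ℚ
    x = frac a m
    y = frac b (k ℕ.* m)
    distribute : ∀ x y κ μ → (x - y) * (κ * μ) ≡ x * μ * κ - y * (κ * μ)
    distribute = solve-∀ ℚ-ring
    scaled : (x - y) * fromℕ (k ℕ.* m) ≡ fromℕ (k ℕ.* a) - fromℕ b
    scaled = begin
      (x - y) * fromℕ (k ℕ.* m)                    ≡⟨ cong ((x - y) *_) (fromℕ-* k m) ⟩
      (x - y) * (fromℕ k * fromℕ m)                ≡⟨ distribute x y (fromℕ k) (fromℕ m) ⟩
      x * fromℕ m * fromℕ k - y * (fromℕ k * fromℕ m)
        ≡⟨ cong₂ (λ z w → z * fromℕ k - w) (frac-*-fromℕ a m>0)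
                 (trans (cong (y *_) (sym (fromℕ-* k m))) (frac-*-fromℕ b (ℕ.*-mono-≤ k>0 m>0))) ⟩
      fromℕ a * fromℕ k - fromℕ b  ≡⟨ cong (_- fromℕ b) (trans (*-comm (fromℕ a) (fromℕ k)) (sym (fromℕ-* k a))) ⟩
      fromℕ (k ℕ.* a) - fromℕ b    ∎

  divergence-node : ∀ {k q h} (ch : Fin k → Tree k q h) → 0 ℕ.< k →
                    divergence (node ch) * fromℕ (k ℕ.^ suc h) * fromℕ k ≡ fromℕ (∑ (nodeDeviation ch))
  divergence-node {k} {q} {h} ch k>0 = begin
    divergence (node ch) * N * κ
      ≡⟨ cong (λ z → frac 1 k * z * N * κ) (trans (sumℚ-allFin (λ y → sumℚ (map (D y) (allFin q)))) (∑ℚ-cong {k} (λ y → sumℚ-allFin (D y)))) ⟩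
    frac 1 k * ∑ℚ (λ y → ∑ℚ (D y)) * N * κ
      ≡⟨ regroup (frac 1 k) (∑ℚ (λ y → ∑ℚ (D y))) N κ ⟩
    frac 1 k * κ * (∑ℚ (λ y → ∑ℚ (D y)) * N)
      ≡⟨ cong₂ _*_ (frac-*-fromℕ 1 k>0) (trans (*-distribʳ-∑ℚ N (λ y → ∑ℚ (D y))) (∑ℚ-cong {k} (λ y → *-distribʳ-∑ℚ N (D y)))) ⟩
    1ℚ * ∑ℚ (λ y → ∑ℚ (λ i → D y i * N))
      ≡⟨ *-identityˡ _ ⟩
    ∑ℚ (λ y → ∑ℚ (λ i → D y i * N))
      ≡⟨ ∑ℚ-cong {k} (λ y → trans (∑ℚ-cong {q} (λ i → ∣frac-frac∣ (count i (ch y)) (count i (node ch)) k>0 (^-positive h k>0)))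
                                  (fromℕ-∑ (λ i → ℕ.∣ k ℕ.* count i (ch y) - count i (node ch) ∣))) ⟩
    ∑ℚ (λ y → fromℕ (nodeDeviation ch y))
      ≡⟨ fromℕ-∑ (nodeDeviation ch) ⟩
    fromℕ (∑ (nodeDeviation ch)) ∎
    where
    open ≡-Reasoning
    N κ : ℚ
    N = fromℕ (k ℕ.^ suc h)
    κ = fromℕ k
    D : Fin k → Fin q → ℚ
    D y i = ∣ μ i (ch y) - μ i (node ch) ∣
    regroup : ∀ f S N κ → f * S * N * κ ≡ f * κ * (S * N)
    regroup = solve-∀ ℚ-ring

  totalDivergence≡deviation : ∀ {k q} → 0 ℕ.< k → ∀ h (T : Tree k q h) → totalDivergence T * fromℕ k ≡ fromℕ (deviation T)
  totalDivergence≡deviation {k} k>0 zero (leaf _) = *-zeroˡ (fromℕ k)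
  totalDivergence≡deviation {k} k>0 (suc h) (node ch) = begin
    totalDivergence (node ch) * κ
      ≡⟨ cong (_* κ) (totalDivergence-node ch) ⟩
    (N * divergence (node ch) + ∑ℚ (λ j → totalDivergence (ch j))) * κ
      ≡⟨ distribute N (divergence (node ch)) (∑ℚ (λ j → totalDivergence (ch j))) κ ⟩
    divergence (node ch) * N * κ + ∑ℚ (λ j → totalDivergence (ch j)) * κ
      ≡⟨ cong₂ _+_ (divergence-node ch k>0) children ⟩
    fromℕ (∑ (nodeDeviation ch)) + fromℕ (∑ (λ j → deviation (ch j)))
      ≡⟨ fromℕ-+ (∑ (nodeDeviation ch)) (∑ (λ j → deviation (ch j))) ⟨
    fromℕ (deviation (node ch)) ∎
    where
    open ≡-Reasoning
    N κ : ℚ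
    N = fromℕ (k ℕ.^ suc h)
    κ = fromℕ k
    distribute : ∀ N d S κ → (N * d + S) * κ ≡ d * N * κ + S * κ
    distribute = solve-∀ ℚ-ring
    children : ∑ℚ (λ j → totalDivergence (ch j)) * κ ≡ fromℕ (∑ (λ j → deviation (ch j)))
    children = trans (*-distribʳ-∑ℚ κ (λ j → totalDivergence (ch j)))
                     (trans (∑ℚ-cong {k} (λ j → totalDivergence≡deviation k>0 h (ch j))) (fromℕ-∑ (λ j → deviation (ch j))))

  expectation≡deviation : ∀ {k q d} → 0 ℕ.< k → 0 ℕ.< d → (T : Tree k q d) →
                          expectation T * fromℕ (k ℕ.^ d ℕ.* d ℕ.* k) ≡ fromℕ (deviation T)
  expectation≡deviation {k} {q} {d} k>0 d>0 T = begin
    frac 1 (k ℕ.^ d ℕ.* d) * totalDivergence T * fromℕ (k ℕ.^ d ℕ.* d ℕ.* k)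
      ≡⟨ cong (frac 1 (k ℕ.^ d ℕ.* d) * totalDivergence T *_) (fromℕ-* (k ℕ.^ d ℕ.* d) k) ⟩
    frac 1 (k ℕ.^ d ℕ.* d) * totalDivergence T * (fromℕ (k ℕ.^ d ℕ.* d) * fromℕ k)
      ≡⟨ regroup (frac 1 (k ℕ.^ d ℕ.* d)) (totalDivergence T) (fromℕ (k ℕ.^ d ℕ.* d)) (fromℕ k) ⟩
    frac 1 (k ℕ.^ d ℕ.* d) * fromℕ (k ℕ.^ d ℕ.* d) * (totalDivergence T * fromℕ k)
      ≡⟨ cong₂ _*_ (frac-*-fromℕ 1 (ℕ.*-mono-≤ (^-positive d k>0) d>0)) (totalDivergence≡deviation k>0 d T) ⟩
    1ℚ * fromℕ (deviation T)
      ≡⟨ *-identityˡ (fromℕ (deviation T)) ⟩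
    fromℕ (deviation T) ∎
    where
    open ≡-Reasoning
    regroup : ∀ f W n κ → f * W * (n * κ) ≡ f * n * (W * κ)
    regroup = solve-∀ ℚ-ring

module QuadraticBound where
  open import Tactic.RingSolver using (solve-∀)
  open import Data.Nat
  open import Data.Nat.Properties
  open import Data.Nat.Tactic.RingSolver using () renaming (ring to ℕ-ring)
  open import Data.Integer using (+_)
  import Data.Rational as ℚ
  open import Relation.Binary.PropositionalEquality
  open import Defs
  open NatLemmas
  open RationalLemmas using (fromℕ; fromℕ-*; fromℕ-injective; /-*-fromℕ; ℚ-ring)
  open LabelledTrees using (deviation; powerProduct; powerProduct>0; chain-rule; entropy-bound)
  open PathAverages using (expectation≡deviation)

  quadraticScale : ℕ → ℕ → ℕ
  quadraticScale k d = 2 * k * k * k ^ d * k ^ d * d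

  quadraticScale>0 : ∀ {k d} → 0 < k → 0 < d → 0 < quadraticScale k d
  quadraticScale>0 {k} {d} k>0 d>0 =
    *-mono-≤ (*-mono-≤ (*-mono-≤ (*-mono-≤ (*-mono-≤ {1} {2} (s≤s z≤n) k>0) k>0) (^-positive d k>0)) (^-positive d k>0)) d>0

  squared-deviation-bound : ∀ {k q d} → 0 < k → 0 < d → (T : Tree k q d) →
                            2 ^ (deviation T * deviation T) ≤ q ^ quadraticScale k d
  squared-deviation-bound {k} {q} {d} k>0 d>0 T = ^-cancelʳ-≤ β β>0 (begin
    (2 ^ (Y * Y)) ^ β  ≡⟨ ^-*-assoc 2 (Y * Y) β ⟩
    2 ^ s              ≤⟨ *-cancelˡ-≤-pos (2 ^ s) (^-positive s (s≤s z≤n)) (*-cancelˡ-≤-pos (G ^ K) (^-positive K (powerProduct>0 T)) combined) ⟩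
    q ^ (N * K)        ≡⟨ cong (q ^_) (exponent k N d) ⟩
    q ^ (R * β)        ≡⟨ ^-*-assoc q R β ⟨
    (q ^ R) ^ β        ∎)
    where
    open ≤-Reasoning
    N Y G β K R s : ℕ
    N = k ^ d
    Y = deviation T
    G = powerProduct T
    β = N * d * k
    K = 2 * (β * β) * k
    R = quadraticScale k d
    s = Y * Y * β
    β>0 : 0 < β
    β>0 = *-mono-≤ (*-mono-≤ (^-positive d k>0) d>0) k>0
    exponent : ∀ k N d → N * (2 * ((N * d * k) * (N * d * k)) * k) ≡ 2 * k * k * N * N * d * (N * d * k)
    exponent = solve-∀ ℕ-ring
    combined : G ^ K * (2 ^ s * 2 ^ s) ≤ G ^ K * (2 ^ s * q ^ (N * K))
    combined = begin
      G ^ K * (2 ^ s * 2 ^ s)                    ≡⟨ cong (G ^ K *_) (trans (sym (^-distribˡ-+-* 2 s s)) (cong (2 ^_) (doubled Y N d k))) ⟩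
      G ^ K * 2 ^ (2 * Y * β * Y)                ≡⟨ *-comm (G ^ K) _ ⟩
      2 ^ (2 * Y * β * deviation T) * G ^ K      ≤⟨ chain-rule Y β k>0 β>0 d T ⟩
      (N ^ N) ^ K * 2 ^ (Y * Y * d * k ^ suc d)  ≤⟨ *-monoˡ-≤ _ (^-monoˡ-≤ K (entropy-bound k>0 T)) ⟩
      (G * q ^ N) ^ K * 2 ^ (Y * Y * d * k ^ suc d)
        ≡⟨ cong₂ _*_ (trans (^-distribʳ-* G (q ^ N) K) (cong (G ^ K *_) (^-*-assoc q N K))) (cong (2 ^_) (reorder Y d k N)) ⟩
      G ^ K * q ^ (N * K) * 2 ^ s    ≡⟨ rotate (G ^ K) (q ^ (N * K)) (2 ^ s) ⟩
      G ^ K * (2 ^ s * q ^ (N * K))  ∎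
      where
      doubled : ∀ Y N d k → Y * Y * (N * d * k) + Y * Y * (N * d * k) ≡ 2 * Y * (N * d * k) * Y
      doubled = solve-∀ ℕ-ring
      reorder : ∀ Y d k N → Y * Y * d * (k * N) ≡ Y * Y * (N * d * k)
      reorder = solve-∀ ℕ-ring
      rotate : ∀ g x p → g * x * p ≡ g * (p * x)
      rotate = solve-∀ ℕ-ring

  cleared-hypothesis : ∀ {a b d β Y} .{{_ : NonZero b}} {E : ℚ.ℚ} →
                       (+ a) ℚ./ b ≡ ((+ d) ℚ./ 2) ℚ.* (E ℚ.* E) → E ℚ.* fromℕ β ≡ fromℕ Y →
                       a * (2 * (β * β)) ≡ d * b * (Y * Y)
  cleared-hypothesis {a} {b} {d} {β} {Y} {E} hyp E*β≡Y = fromℕ-injective (begin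
    fromℕ (a * (2 * (β * β)))                                     ≡⟨ fromℕ-*³ a 2 β β ⟩
    fromℕ a ℚ.* (fromℕ 2 ℚ.* (B ℚ.* B))                           ≡⟨ cong (ℚ._* (fromℕ 2 ℚ.* (B ℚ.* B))) (/-*-fromℕ a b) ⟨
    (+ a) ℚ./ b ℚ.* fromℕ b ℚ.* (fromℕ 2 ℚ.* (B ℚ.* B))          ≡⟨ cong (λ x → x ℚ.* fromℕ b ℚ.* (fromℕ 2 ℚ.* (B ℚ.* B))) hyp ⟩
    (+ d) ℚ./ 2 ℚ.* (E ℚ.* E) ℚ.* fromℕ b ℚ.* (fromℕ 2 ℚ.* (B ℚ.* B))
      ≡⟨ regroup ((+ d) ℚ./ 2) E (fromℕ b) (fromℕ 2) B ⟩
    (+ d) ℚ./ 2 ℚ.* fromℕ 2 ℚ.* fromℕ b ℚ.* ((E ℚ.* B) ℚ.* (E ℚ.* B))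
      ≡⟨ cong₂ (λ x y → x ℚ.* fromℕ b ℚ.* (y ℚ.* y)) (/-*-fromℕ d 2) E*β≡Y ⟩
    fromℕ d ℚ.* fromℕ b ℚ.* (fromℕ Y ℚ.* fromℕ Y)  ≡⟨ fromℕ-*³′ d b Y Y ⟨
    fromℕ (d * b * (Y * Y))                        ∎)
    where
    open ≡-Reasoning
    B : ℚ.ℚ
    B = fromℕ β
    regroup : ∀ h E b t B → h ℚ.* (E ℚ.* E) ℚ.* b ℚ.* (t ℚ.* (B ℚ.* B)) ≡ h ℚ.* t ℚ.* b ℚ.* ((E ℚ.* B) ℚ.* (E ℚ.* B))
    regroup = solve-∀ ℚ-ring
    fromℕ-*³ : ∀ w x y z → fromℕ (w * (x * (y * z))) ≡ fromℕ w ℚ.* (fromℕ x ℚ.* (fromℕ y ℚ.* fromℕ z))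
    fromℕ-*³ w x y z = trans (fromℕ-* w _) (cong (fromℕ w ℚ.*_) (trans (fromℕ-* x _) (cong (fromℕ x ℚ.*_) (fromℕ-* y z))))
    fromℕ-*³′ : ∀ w x y z → fromℕ (w * x * (y * z)) ≡ fromℕ w ℚ.* fromℕ x ℚ.* (fromℕ y ℚ.* fromℕ z)
    fromℕ-*³′ w x y z = trans (fromℕ-* (w * x) _) (cong₂ ℚ._*_ (fromℕ-* w x) (fromℕ-* y z))

  hypothesis-as-exponents : ∀ {k q d} → 0 < k → 0 < d → (T : Tree k q d) → ∀ a b .{{_ : NonZero b}} →
                            (+ a) ℚ./ b ≡ ((+ d) ℚ./ 2) ℚ.* (expectation T ℚ.* expectation T) →
                            a * quadraticScale k d ≡ b * (deviation T * deviation T)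
  hypothesis-as-exponents {k} {q} {d} k>0 d>0 T a b hyp = *-cancelˡ-≡ _ _ d {{>-nonZero d>0}} (begin
    d * (a * quadraticScale k d)    ≡⟨ regroup a k (k ^ d) d ⟩
    a * (2 * (β * β))               ≡⟨ cleared-hypothesis {a} {b} {d} {β} {Y} {expectation T} hyp (expectation≡deviation k>0 d>0 T) ⟩
    d * b * (Y * Y)                 ≡⟨ *-assoc d b (Y * Y) ⟩
    d * (b * (Y * Y))               ∎)
    where
    open ≡-Reasoning
    Y β : ℕ
    Y = deviation T
    β = k ^ d * d * k
    regroup : ∀ a k N d → d * (a * (2 * k * k * N * N * d)) ≡ a * (2 * ((N * d * k) * (N * d * k)))
    regroup = solve-∀ ℕ-ring

open import Defs
open import Data.Nat using (ℕ; _≤_; _^_; NonZero)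
open import Data.Integer using (+_)
open import Data.Rational using (ℚ; _*_; _/_)
open import Relation.Binary.PropositionalEquality using (_≡_)
import Data.Nat as ℕ
open NatLemmas using (^-≤-rescale)
open LabelledTrees using (deviation)
open QuadraticBound using (quadraticScale>0; squared-deviation-bound; hypothesis-as-exponents)

lemma12 : (k q d : ℕ) → 1 ≤ k → 1 ≤ d → (T : Tree k q d) →
    (a b : ℕ) → .{{_ : NonZero b}} →
    (+ a) / b ≡ ((+ d) / 2) * (expectation T * expectation T) →
    2 ^ a ≤ q ^ b
lemma12 k q d k≥1 d≥1 T a b hyp =
  ^-≤-rescale {2} {q} {a} {b} {deviation T ℕ.* deviation T}
    (quadraticScale>0 k≥1 d≥1) (hypothesis-as-exponents k≥1 d≥1 T a b hyp) (squared-deviation-bound k≥1 d≥1 T)
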